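{- Assume TC(2). Then every integer $g$ with $g\ne-1$ and $g$ not a perfect square is a primitive root modulo infinitely many primes $p$.
   Context: TC(2) is the statement: for all integers $A_1,A_2,B_1,B_2$ with $A_1,A_2>0$ such that for every prime $p$ there is an integer $n_p$ with $p\nmid(A_1n_p+B_1)(A_2n_p+B_2)$, there exist infinitely many integers $n$ such that $A_1n+B_1$ and $A_2n+B_2$ are both prime. -}

module Defs where

open import Data.Nat as ℕ using (ℕ; suc)
open import Data.Nat.Primality using (Prime)
open import Data.Integer as ℤ using (ℤ; +_; ∣_∣)
open import Data.Integer.Divisibility using (_∣_)
open import Data.Product using (Σ; ∃; _×_; _,_)
open import Relation.Nullary using (¬_)
open import Relation.Binary.PropositionalEquality using (_≡_)

IsPrimeℤ : ℤ → Set
IsPrimeℤ z = Σ ℕ (λ q → (z ≡ + q) × Prime q)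

InfinitelyManyℤ : (ℤ → Set) → Set
InfinitelyManyℤ P = (N : ℕ) → Σ ℤ (λ n → (N ℕ.≤ ∣ n ∣) × P n)

InfinitelyManyℕ : (ℕ → Set) → Set
InfinitelyManyℕ P = (N : ℕ) → Σ ℕ (λ n → (N ℕ.≤ n) × P n)

TC2 : Set
TC2 = (A₁ A₂ : ℤ) (B₁ B₂ : ℤ) → ℤ.0ℤ ℤ.< A₁ → ℤ.0ℤ ℤ.< A₂ →
      ((p : ℕ) → Prime p →
         Σ ℤ (λ nₚ → ¬ ((+ p) ∣ ((A₁ ℤ.* nₚ ℤ.+ B₁) ℤ.* (A₂ ℤ.* nₚ ℤ.+ B₂))))) →
      InfinitelyManyℤ (λ n → IsPrimeℤ (A₁ ℤ.* n ℤ.+ B₁) × IsPrimeℤ (A₂ ℤ.* n ℤ.+ B₂))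

IsSquare : ℤ → Set
IsSquare g = Σ ℤ (λ m → g ≡ m ℤ.* m)

-- g is a primitive root modulo the prime p: p ∤ g, and the multiplicative order
-- of g modulo p is exactly p - 1, i.e. p ∤ g^k - 1 for every 1 ≤ k < p - 1.
-- (By Fermat, g^(p-1) ≡ 1 mod p automatically when p ∤ g.)
IsPrimitiveRoot : ℤ → ℕ → Set
IsPrimitiveRoot g p =
  ¬ ((+ p) ∣ g) ×
  ((k : ℕ) → 1 ℕ.≤ k → k ℕ.< p ℕ.∸ 1 → ¬ ((+ p) ∣ (g ℤ.^ k ℤ.- ℤ.1ℤ)))

{-# OPTIONS --safe #-}
-- If q and p = 2jq + 1 are prime (j = 1 or 2), p is large and g is a quadratic non-residue modulo p,
-- i.e. g ^ (jq) ≡ -1, then the order of g divides 2jq but none of its proper divisors, so g is a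
-- primitive root modulo p. TC(2) supplies infinitely many such pairs (q, p) with q in any admissible
-- progression A m + B, so it suffices to choose A and B making g a non-residue modulo every such p.
-- Write g = ±t²ℓb with ℓ prime, ℓ ∤ b. Taking q in a suitable class modulo 4bℓ gives 8b ∣ p + 1,
-- which makes b a residue modulo p, fixes the characters of -1 and 2 through p mod 8, and, by quadratic
-- reciprocity, fixes the character of an odd ℓ through p mod ℓ; the residue class is chosen so that
-- these characters multiply to -1. The shapes -t² and 3u² are handled by p = 4m + 3 and p = 24m + 5.
-- Reciprocity is proved via the lemmas of Gauss and Eisenstein, and a non-residue modulo ℓ is found
-- by means of power sums.
module Submission where

open import Defs
open import Data.Nat as ℕ
  using (ℕ; zero; suc; _+_; _*_; _^_; _∸_; _%_; _/_; _≤_; _<_; z≤n; s≤s; _≟_; _<?_; _≤?_; NonZero)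
import Data.Nat.Properties as ℕₚ
import Data.Nat.DivMod as ℕ÷
open import Data.Nat.Combinatorics using (_C_; nCk+nC[k+1]≡[n+1]C[k+1]; k>n⇒nCk≡0; nCn≡1; nC1≡n; nCk≡nC[n∸k])
open import Data.Nat.Divisibility
  using (_∣_; _∣?_; divides; ∣⇒≤; ∣-refl; ∣-trans; ∣m+n∣m⇒∣n; ∣m∣n⇒∣m+n; m∣m*n; ∣n⇒∣m*n; m%n≡0⇒n∣m)
open import Data.Nat.Coprimality using (Coprime; coprime-Bézout)
import Data.Nat.GCD as GCD
open GCD using (module Bézout)
open import Data.Nat.Primality using (Prime; euclidsLemma; prime⇒irreducible; prime⇒nonTrivial; prime[2]; prime?)
open import Data.Nat.Tactic.RingSolver using (solve-∀)
open import Data.Nat.Induction using (<-wellFounded)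
open import Induction.WellFounded using (Acc; acc)
open import Data.Integer as ℤ using (ℤ; +_; -[1+_]; ∣_∣)
import Data.Integer.Properties as ℤₚ
import Data.Integer.Divisibility.Signed as ℤ÷
open import Data.Integer.Divisibility using () renaming (_∣_ to _∣ᵤ_)
import Data.Integer.Tactic.RingSolver as ℤRing
open import Data.Product using (∃; _×_; _,_; proj₁; proj₂)
open import Data.List using ([]; _∷_)
open import Data.List.Relation.Unary.All using ([]; _∷_)
open import Data.Nat.ListAction using (product)
open import Data.Nat.Primality.Factorisation using (factorise)
open import Data.Sum using (_⊎_; inj₁; inj₂; [_,_]′)
open import Data.Empty using (⊥; ⊥-elim)
open import Relation.Nullary using (¬_; Dec; yes; no)
open import Relation.Nullary.Decidable using (from-yes)
open import Relation.Unary using (Decidable)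
open import Relation.Binary using (Setoid; IsEquivalence; tri<; tri≈; tri>)
open import Relation.Binary.PropositionalEquality
open import Function using (_∘_; id)
open import Level using (0ℓ)
import Relation.Binary.Reasoning.Setoid

infix 4 _≡_[mod_]
record _≡_[mod_] (x y : ℤ) (m : ℕ) : Set where
  constructor mod
  field divides-difference : + m ℤ÷.∣ x ℤ.- y
open _≡_[mod_] public

module _ {m : ℕ} where

  mod-reflexive : ∀ {x y} → x ≡ y → x ≡ y [mod m ]
  mod-reflexive {x} refl = mod (ℤ÷.divides (+ 0) (ℤₚ.+-inverseʳ x))

  mod-refl : ∀ {x} → x ≡ x [mod m ]
  mod-refl = mod-reflexive refl

  mod-sym : ∀ {x y} → x ≡ y [mod m ] → y ≡ x [mod m ]
  mod-sym {x} {y} (mod d) = mod (subst (+ m ℤ÷.∣_) (identity x y) (ℤ÷.∣m⇒∣-m d))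
    where identity : ∀ x y → ℤ.- (x ℤ.- y) ≡ y ℤ.- x
          identity = ℤRing.solve-∀

  mod-trans : ∀ {x y z} → x ≡ y [mod m ] → y ≡ z [mod m ] → x ≡ z [mod m ]
  mod-trans {x} {y} {z} (mod d) (mod e) = mod (subst (+ m ℤ÷.∣_) (identity x y z) (ℤ÷.∣m∣n⇒∣m+n d e))
    where identity : ∀ x y z → (x ℤ.- y) ℤ.+ (y ℤ.- z) ≡ x ℤ.- z
          identity = ℤRing.solve-∀

  mod-isEquivalence : IsEquivalence (λ x y → x ≡ y [mod m ])
  mod-isEquivalence = record { refl = mod-refl ; sym = mod-sym ; trans = mod-trans }

  mod-+ : ∀ {x y u v} → x ≡ y [mod m ] → u ≡ v [mod m ] → x ℤ.+ u ≡ y ℤ.+ v [mod m ]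
  mod-+ {x} {y} {u} {v} (mod d) (mod e) = mod (subst (+ m ℤ÷.∣_) (identity x y u v) (ℤ÷.∣m∣n⇒∣m+n d e))
    where identity : ∀ x y u v → (x ℤ.- y) ℤ.+ (u ℤ.- v) ≡ (x ℤ.+ u) ℤ.- (y ℤ.+ v)
          identity = ℤRing.solve-∀

  mod-* : ∀ {x y u v} → x ≡ y [mod m ] → u ≡ v [mod m ] → x ℤ.* u ≡ y ℤ.* v [mod m ]
  mod-* {x} {y} {u} {v} (mod d) (mod e) =
    mod (subst (+ m ℤ÷.∣_) (identity x y u v) (ℤ÷.∣m∣n⇒∣m+n (ℤ÷.∣n⇒∣m*n x e) (ℤ÷.∣m⇒∣m*n v d)))
    where identity : ∀ x y u v → x ℤ.* (u ℤ.- v) ℤ.+ (x ℤ.- y) ℤ.* v ≡ x ℤ.* u ℤ.- y ℤ.* v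
          identity = ℤRing.solve-∀

  mod-^ : ∀ {x y} n → x ≡ y [mod m ] → x ℤ.^ n ≡ y ℤ.^ n [mod m ]
  mod-^ zero    _   = mod-refl
  mod-^ (suc n) x≡y = mod-* x≡y (mod-^ n x≡y)

  +-multiple-mod : ∀ x k → x ℤ.+ k ℤ.* + m ≡ x [mod m ]
  +-multiple-mod x k = mod (ℤ÷.divides k (identity x k (+ m)))
    where identity : ∀ x k m → (x ℤ.+ k ℤ.* m) ℤ.- x ≡ k ℤ.* m
          identity = ℤRing.solve-∀

  self≡0[mod] : + m ≡ + 0 [mod m ]
  self≡0[mod] = mod (ℤ÷.divides (+ 1) (trans (ℤₚ.+-identityʳ (+ m)) (sym (ℤₚ.*-identityˡ (+ m)))))

  mod-0⇒∣ : ∀ {x} → x ≡ + 0 [mod m ] → + m ℤ÷.∣ x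
  mod-0⇒∣ {x} (mod d) = subst (+ m ℤ÷.∣_) (ℤₚ.+-identityʳ x) d

  ∣⇒mod-0 : ∀ {x} → + m ℤ÷.∣ x → x ≡ + 0 [mod m ]
  ∣⇒mod-0 {x} d = mod (subst (+ m ℤ÷.∣_) (sym (ℤₚ.+-identityʳ x)) d)

  1≢-1[mod] : 2 < m → ¬ (+ 1 ≡ ℤ.- + 1 [mod m ])
  1≢-1[mod] 2<m (mod d) = ℕₚ.<⇒≱ 2<m (∣⇒≤ (ℤ÷.∣⇒∣ᵤ d))

modSetoid : ℕ → Setoid 0ℓ 0ℓ
modSetoid m = record { isEquivalence = mod-isEquivalence {m} }

module ≡-mod-Reasoning (m : ℕ) = Relation.Binary.Reasoning.Setoid (modSetoid m)

private
  ≤∧mod⇒%≡ : ∀ {m x y} → y ≤ x → + x ≡ + y [mod suc m ] → x % suc m ≡ y % suc m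
  ≤∧mod⇒%≡ {m} {x} {y} y≤x (mod d) = trans (cong (_% suc m) (sym (ℕₚ.m+[n∸m]≡n y≤x))) (ℕ÷.%-remove-+ʳ y m∣x∸y)
    where
    ∣+x-+y∣ : ∣ + x ℤ.- + y ∣ ≡ x ∸ y
    ∣+x-+y∣ = trans (cong ∣_∣ (ℤₚ.[+m]-[+n]≡m⊖n x y)) (trans (ℤₚ.∣m⊖n∣≡∣n⊖m∣ x y) (ℤₚ.∣⊖∣-≤ y≤x))
    m∣x∸y : suc m ∣ x ∸ y
    m∣x∸y = subst (suc m ∣_) ∣+x-+y∣ (ℤ÷.∣⇒∣ᵤ d)

mod⇒%≡ : ∀ {m} x y → + x ≡ + y [mod suc m ] → x % suc m ≡ y % suc m
mod⇒%≡ x y x≡y with ℕₚ.≤-total y x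
... | inj₁ y≤x = ≤∧mod⇒%≡ y≤x x≡y
... | inj₂ x≤y = sym (≤∧mod⇒%≡ x≤y (mod-sym x≡y))

mod⇒≡ : ∀ {P} x y → x < P → y < P → + x ≡ + y [mod P ] → x ≡ y
mod⇒≡ {suc m} x y x<P y<P x≡y = begin
  x            ≡⟨ ℕ÷.m<n⇒m%n≡m x<P ⟨
  x % suc m    ≡⟨ mod⇒%≡ x y x≡y ⟩
  y % suc m    ≡⟨ ℕ÷.m<n⇒m%n≡m y<P ⟩
  y            ∎
  where open ≡-Reasoning

mod-∣ : ∀ {m x y} → + x ≡ + y [mod m ] → m ∣ x → m ∣ y
mod-∣ x≡y m∣x = ℤ÷.∣⇒∣ᵤ (mod-0⇒∣ (mod-trans (mod-sym x≡y) (∣⇒mod-0 (ℤ÷.∣ᵤ⇒∣ m∣x))))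

prime⇒2≤ : ∀ {p} → Prime p → 2 ≤ p
prime⇒2≤ {p} p-prime = ℕ.nonTrivial⇒n>1 p {{prime⇒nonTrivial p-prime}}

prime∤1 : ∀ {p} → Prime p → ¬ p ∣ 1
prime∤1 p-prime p∣1 = ℕₚ.<⇒≱ (prime⇒2≤ p-prime) (∣⇒≤ p∣1)

prime∤-small : ∀ {p k} → 1 ≤ k → k < p → ¬ p ∣ k
prime∤-small 1≤k k<p p∣k = ℕₚ.<⇒≱ k<p (∣⇒≤ {{ℕ.>-nonZero 1≤k}} p∣k)

prime-∣-*ℤ : ∀ {p} x y → Prime p → + p ℤ÷.∣ x ℤ.* y → + p ℤ÷.∣ x ⊎ + p ℤ÷.∣ y
prime-∣-*ℤ x y p-prime d with euclidsLemma ∣ x ∣ ∣ y ∣ p-prime (subst (_ ∣_) (ℤₚ.abs-* x y) (ℤ÷.∣⇒∣ᵤ d))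
... | inj₁ p∣x = inj₁ (ℤ÷.∣ᵤ⇒∣ p∣x)
... | inj₂ p∣y = inj₂ (ℤ÷.∣ᵤ⇒∣ p∣y)

mod-cancelʳ : ∀ {p x y} c → Prime p → ¬ + p ℤ÷.∣ c → x ℤ.* c ≡ y ℤ.* c [mod p ] → x ≡ y [mod p ]
mod-cancelʳ {p} {x} {y} c p-prime p∤c (mod d) with prime-∣-*ℤ (x ℤ.- y) c p-prime (subst (+ p ℤ÷.∣_) (identity x y c) d)
  where identity : ∀ x y c → x ℤ.* c ℤ.- y ℤ.* c ≡ (x ℤ.- y) ℤ.* c
        identity = ℤRing.solve-∀
... | inj₁ p∣x-y = mod p∣x-y
... | inj₂ p∣c   = ⊥-elim (p∤c p∣c)

^-distrib-* : ∀ x y n → (x ℤ.* y) ℤ.^ n ≡ x ℤ.^ n ℤ.* y ℤ.^ n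
^-distrib-* x y zero    = refl
^-distrib-* x y (suc n) = trans (cong (x ℤ.* y ℤ.*_) (^-distrib-* x y n)) (identity x y (x ℤ.^ n) (y ℤ.^ n))
  where identity : ∀ x y a b → x ℤ.* y ℤ.* (a ℤ.* b) ≡ x ℤ.* a ℤ.* (y ℤ.* b)
        identity = ℤRing.solve-∀

pos-^ : ∀ a n → (+ a) ℤ.^ n ≡ + (a ^ n)
pos-^ a zero    = refl
pos-^ a (suc n) = trans (cong (+ a ℤ.*_) (pos-^ a n)) (sym (ℤₚ.pos-* a (a ^ n)))

infix 8 -1^_
-1^_ : ℕ → ℤ
-1^ zero  = + 1
-1^ suc n = ℤ.- -1^ n

-1^-+ : ∀ m n → -1^ (m + n) ≡ -1^ m ℤ.* -1^ n
-1^-+ zero    n = sym (ℤₚ.*-identityˡ (-1^ n))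
-1^-+ (suc m) n = trans (cong ℤ.-_ (-1^-+ m n)) (ℤₚ.neg-distribˡ-* (-1^ m) (-1^ n))

-1^-2* : ∀ n → -1^ (2 * n) ≡ + 1
-1^-2* zero    = refl
-1^-2* (suc n) = begin
  ℤ.- -1^ (n + suc (n + 0))  ≡⟨ cong (ℤ.-_ ∘ -1^_) (ℕₚ.+-suc n (n + 0)) ⟩
  ℤ.- ℤ.- -1^ (2 * n)        ≡⟨ ℤₚ.neg-involutive (-1^ (2 * n)) ⟩
  -1^ (2 * n)                ≡⟨ -1^-2* n ⟩
  + 1                        ∎
  where open ≡-Reasoning

-1^-cases : ∀ n → -1^ n ≡ + 1 ⊎ -1^ n ≡ ℤ.- + 1
-1^-cases zero    = inj₁ refl
-1^-cases (suc n) with -1^-cases n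
... | inj₁ e = inj₂ (cong ℤ.-_ e)
... | inj₂ e = inj₁ (cong ℤ.-_ e)

-1^-square : ∀ n → -1^ n ℤ.* -1^ n ≡ + 1
-1^-square n = begin
  -1^ n ℤ.* -1^ n  ≡⟨ -1^-+ n n ⟨
  -1^ (n + n)      ≡⟨ cong -1^_ (cong (_+_ n) (sym (ℕₚ.+-identityʳ n))) ⟩
  -1^ (2 * n)      ≡⟨ -1^-2* n ⟩
  + 1              ∎
  where open ≡-Reasoning

-1^-odd* : ∀ a n → -1^ (suc (2 * a) * n) ≡ -1^ n
-1^-odd* a n = begin
  -1^ (suc (2 * a) * n)          ≡⟨ cong -1^_ (identity a n) ⟩
  -1^ (n + 2 * (a * n))          ≡⟨ -1^-+ n (2 * (a * n)) ⟩
  -1^ n ℤ.* -1^ (2 * (a * n))    ≡⟨ cong (-1^ n ℤ.*_) (-1^-2* (a * n)) ⟩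
  -1^ n ℤ.* + 1                  ≡⟨ ℤₚ.*-identityʳ (-1^ n) ⟩
  -1^ n                          ∎
  where
  open ≡-Reasoning
  identity : ∀ a n → suc (2 * a) * n ≡ n + 2 * (a * n)
  identity = solve-∀

-1^-difference : ∀ x y {z} → x + y ≡ z → -1^ x ≡ -1^ z ℤ.* -1^ y
-1^-difference x y refl = begin
  -1^ x                              ≡⟨ ℤₚ.*-identityʳ (-1^ x) ⟨
  -1^ x ℤ.* + 1                      ≡⟨ cong (-1^ x ℤ.*_) (-1^-square y) ⟨
  -1^ x ℤ.* (-1^ y ℤ.* -1^ y)        ≡⟨ ℤₚ.*-assoc (-1^ x) (-1^ y) (-1^ y) ⟨
  -1^ x ℤ.* -1^ y ℤ.* -1^ y          ≡⟨ cong (ℤ._* -1^ y) (-1^-+ x y) ⟨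
  -1^ (x + y) ℤ.* -1^ y              ∎
  where open ≡-Reasoning

-1^-parity : ∀ x y {c d} → x + y + 2 * c ≡ 2 * d → -1^ x ≡ -1^ y
-1^-parity x y {c} {d} e = begin
  -1^ x                              ≡⟨ -1^-difference x y refl ⟩
  -1^ (x + y) ℤ.* -1^ y              ≡⟨ cong (ℤ._* -1^ y) (-1^-difference (x + y) (2 * c) e) ⟩
  -1^ (2 * d) ℤ.* -1^ (2 * c) ℤ.* -1^ y
    ≡⟨ cong₂ (λ u v → u ℤ.* v ℤ.* -1^ y) (-1^-2* d) (-1^-2* c) ⟩
  + 1 ℤ.* + 1 ℤ.* -1^ y              ≡⟨ ℤₚ.*-identityˡ (-1^ y) ⟩
  -1^ y                              ∎
  where open ≡-Reasoning

-1^-^ : ∀ e n → (-1^ e) ℤ.^ n ≡ -1^ (e * n)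
-1^-^ e zero    = cong -1^_ (sym (ℕₚ.*-zeroʳ e))
-1^-^ e (suc n) = begin
  -1^ e ℤ.* (-1^ e) ℤ.^ n  ≡⟨ cong (-1^ e ℤ.*_) (-1^-^ e n) ⟩
  -1^ e ℤ.* -1^ (e * n)    ≡⟨ -1^-+ e (e * n) ⟨
  -1^ (e + e * n)          ≡⟨ cong -1^_ (ℕₚ.*-suc e n) ⟨
  -1^ (e * suc n)          ∎
  where open ≡-Reasoning

∣-1^e*a∣ : ∀ e a → ∣ -1^ e ℤ.* + a ∣ ≡ a
∣-1^e*a∣ e a = trans (ℤₚ.abs-* (-1^ e) (+ a)) (trans (cong (_* a) (∣-1^e∣ e)) (ℕₚ.*-identityˡ a))
  where
  ∣-1^e∣ : ∀ e → ∣ -1^ e ∣ ≡ 1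
  ∣-1^e∣ zero    = refl
  ∣-1^e∣ (suc e) = trans (ℤₚ.∣-i∣≡∣i∣ (-1^ e)) (∣-1^e∣ e)

-1^-mod⇒≡ : ∀ {p} m n → 2 < p → -1^ m ≡ -1^ n [mod p ] → -1^ m ≡ -1^ n
-1^-mod⇒≡ m n 2<p e with -1^-cases m | -1^-cases n
... | inj₁ a | inj₁ b = trans a (sym b)
... | inj₂ a | inj₂ b = trans a (sym b)
... | inj₁ a | inj₂ b = ⊥-elim (1≢-1[mod] 2<p (subst₂ _≡_[mod _ ] a b e))
... | inj₂ a | inj₁ b = ⊥-elim (1≢-1[mod] 2<p (mod-sym (subst₂ _≡_[mod _ ] a b e)))

search : ∀ {Q : ℕ → Set} → Decidable Q → ∀ n →
         (∃ λ c → 1 ≤ c × c ≤ n × Q c) ⊎ (∀ c → 1 ≤ c → c ≤ n → ¬ Q c)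
search Q? zero = inj₂ (λ c 1≤c c≤0 _ → ℕₚ.<⇒≱ 1≤c c≤0)
search {Q} Q? (suc n) with Q? (suc n) | search Q? n
... | yes q | _                      = inj₁ (suc n , s≤s z≤n , ℕₚ.≤-refl , q)
... | no _  | inj₁ (c , 1≤c , c≤n , q) = inj₁ (c , 1≤c , ℕₚ.m≤n⇒m≤1+n c≤n , q)
... | no ¬q | inj₂ none              = inj₂ none′
  where
  none′ : ∀ c → 1 ≤ c → c ≤ suc n → ¬ Q c
  none′ c 1≤c c≤1+n with ℕₚ.m≤n⇒m<n∨m≡n c≤1+n
  ... | inj₁ c<1+n = none c 1≤c (ℕₚ.≤-pred c<1+n)
  ... | inj₂ refl  = ¬q

update : (ℕ → ℕ) → ℕ → ℕ → ℕ → ℕ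
update f k₀ v k with k ≟ k₀
... | yes _ = v
... | no _  = f k

update-≢ : ∀ f k₀ v {k} → k ≢ k₀ → update f k₀ v k ≡ f k
update-≢ f k₀ v {k} k≢k₀ with k ≟ k₀
... | yes k≡k₀ = ⊥-elim (k≢k₀ k≡k₀)
... | no _     = refl

update-≡ : ∀ f k₀ v → update f k₀ v k₀ ≡ v
update-≡ f k₀ v with k₀ ≟ k₀
... | yes _ = refl
... | no k₀≢k₀ = ⊥-elim (k₀≢k₀ refl)

≤∧≢⇒≤-pred : ∀ {a b} → a ≤ suc b → a ≢ suc b → a ≤ b
≤∧≢⇒≤-pred a≤1+b a≢1+b = ℕₚ.≤-pred (ℕₚ.≤∧≢⇒< a≤1+b a≢1+b)

record InjectiveInto (f : ℕ → ℕ) (m n : ℕ) : Set where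
  field
    bounded   : ∀ k → 1 ≤ k → k ≤ m → 1 ≤ f k × f k ≤ n
    injective : ∀ j k → 1 ≤ j → j ≤ m → 1 ≤ k → k ≤ m → f j ≡ f k → j ≡ k
open InjectiveInto

module _ {f : ℕ → ℕ} {m n : ℕ} (inj : InjectiveInto f (suc m) (suc n)) where

  private
    weaken : ∀ {k} → k ≤ m → k ≤ suc m
    weaken = ℕₚ.m≤n⇒m≤1+n

  InjectiveInto-swap : ∀ k₀ → 1 ≤ k₀ → k₀ ≤ suc m → f k₀ ≡ suc n →
                       InjectiveInto (update f k₀ (f (suc m))) m n
  InjectiveInto-swap k₀ 1≤k₀ k₀≤ fk₀ = record { bounded = bounded′ ; injective = injective′ }
    where
    fmax : 1 ≤ f (suc m) × f (suc m) ≤ suc n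
    fmax = bounded inj (suc m) (s≤s z≤n) ℕₚ.≤-refl
    last≢ : ∀ k → 1 ≤ k → k ≤ m → f (suc m) ≢ f k
    last≢ k 1≤k k≤m e = ℕₚ.<⇒≢ (s≤s k≤m) (sym (injective inj (suc m) k (s≤s z≤n) ℕₚ.≤-refl 1≤k (weaken k≤m) e))
    g : ℕ → ℕ
    g = update f k₀ (f (suc m))
    bounded′ : ∀ k → 1 ≤ k → k ≤ m → 1 ≤ g k × g k ≤ n
    bounded′ k 1≤k k≤m with k ≟ k₀
    ... | yes refl = proj₁ fmax , ≤∧≢⇒≤-pred (proj₂ fmax) (λ e → last≢ k 1≤k k≤m (trans e (sym fk₀)))
    ... | no k≢k₀  = proj₁ fk , ≤∧≢⇒≤-pred (proj₂ fk)
                       (λ e → k≢k₀ (injective inj k k₀ 1≤k (weaken k≤m) 1≤k₀ k₀≤ (trans e (sym fk₀))))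
      where fk : 1 ≤ f k × f k ≤ suc n
            fk = bounded inj k 1≤k (weaken k≤m)
    injective′ : ∀ j k → 1 ≤ j → j ≤ m → 1 ≤ k → k ≤ m → g j ≡ g k → j ≡ k
    injective′ j k 1≤j j≤m 1≤k k≤m e with j ≟ k₀ | k ≟ k₀
    ... | yes refl | yes refl = refl
    ... | yes refl | no _     = ⊥-elim (last≢ k 1≤k k≤m e)
    ... | no _     | yes refl = ⊥-elim (last≢ j 1≤j j≤m (sym e))
    ... | no _     | no _     = injective inj j k 1≤j (weaken j≤m) 1≤k (weaken k≤m) e

  InjectiveInto-shrink : (∀ k → 1 ≤ k → k ≤ suc m → f k ≢ suc n) → InjectiveInto f (suc m) n
  InjectiveInto-shrink avoid = record
    { bounded   = λ k 1≤k k≤ → proj₁ (bounded inj k 1≤k k≤) , ≤∧≢⇒≤-pred (proj₂ (bounded inj k 1≤k k≤)) (avoid k 1≤k k≤)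
    ; injective = injective inj
    }

preimage : ∀ (f : ℕ → ℕ) n m → (∃ λ k → 1 ≤ k × k ≤ m × f k ≡ n) ⊎ (∀ k → 1 ≤ k → k ≤ m → f k ≢ n)
preimage f n = search (λ k → f k ≟ n)

pigeonhole : ∀ {n m} (f : ℕ → ℕ) → n < m → ¬ InjectiveInto f m n
pigeonhole {zero} {suc m} f _ inj = ℕₚ.<⇒≱ (proj₁ f1) (proj₂ f1)
  where f1 : 1 ≤ f 1 × f 1 ≤ 0
        f1 = bounded inj 1 (s≤s z≤n) (s≤s z≤n)
pigeonhole {suc n} {suc m} f (s≤s n<m) inj with preimage f (suc n) (suc m)
... | inj₁ (k₀ , 1≤k₀ , k₀≤ , fk₀) = pigeonhole (update f k₀ (f (suc m))) n<m (InjectiveInto-swap inj k₀ 1≤k₀ k₀≤ fk₀)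
... | inj₂ avoid = pigeonhole f (ℕₚ.m≤n⇒m≤1+n n<m) (InjectiveInto-shrink inj avoid)

module Fold {A : Set} (_⊕_ : A → A → A) (ε : A)
            (assoc : ∀ a b c → (a ⊕ b) ⊕ c ≡ a ⊕ (b ⊕ c))
            (comm : ∀ a b → a ⊕ b ≡ b ⊕ a) where

  foldTo : (ℕ → A) → ℕ → A
  foldTo f zero    = ε
  foldTo f (suc n) = foldTo f n ⊕ f (suc n)

  foldTo-cong : ∀ {f g} n → (∀ k → 1 ≤ k → k ≤ n → f k ≡ g k) → foldTo f n ≡ foldTo g n
  foldTo-cong zero    f≗g = refl
  foldTo-cong (suc n) f≗g =
    cong₂ _⊕_ (foldTo-cong n (λ k 1≤k k≤n → f≗g k 1≤k (ℕₚ.m≤n⇒m≤1+n k≤n))) (f≗g (suc n) (s≤s z≤n) ℕₚ.≤-refl)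

  private
    swapʳ : ∀ a b c → (a ⊕ b) ⊕ c ≡ (a ⊕ c) ⊕ b
    swapʳ a b c = trans (assoc a b c) (trans (cong (a ⊕_) (comm b c)) (sym (assoc a c b)))

  foldTo-update : ∀ (g : ℕ → A) σ k₀ v n → 1 ≤ k₀ → k₀ ≤ n →
                  foldTo (g ∘ update σ k₀ v) n ⊕ g (σ k₀) ≡ foldTo (g ∘ σ) n ⊕ g v
  foldTo-update g σ k₀ v zero 1≤k₀ k₀≤0 = ⊥-elim (ℕₚ.<⇒≱ 1≤k₀ k₀≤0)
  foldTo-update g σ k₀ v (suc n) 1≤k₀ k₀≤ with ℕₚ.m≤n⇒m<n∨m≡n k₀≤
  ... | inj₂ refl = begin
    (foldTo (g ∘ σ′) n ⊕ g (σ′ (suc n))) ⊕ g (σ (suc n))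
      ≡⟨ cong₂ (λ a b → (a ⊕ g b) ⊕ g (σ (suc n)))
               (foldTo-cong n (λ k _ k≤n → cong g (update-≢ σ k₀ v (ℕₚ.<⇒≢ (s≤s k≤n)))))
               (update-≡ σ k₀ v) ⟩
    (foldTo (g ∘ σ) n ⊕ g v) ⊕ g (σ (suc n))   ≡⟨ swapʳ _ _ _ ⟩
    (foldTo (g ∘ σ) n ⊕ g (σ (suc n))) ⊕ g v   ∎
    where open ≡-Reasoning
          σ′ : ℕ → ℕ
          σ′ = update σ k₀ v
  ... | inj₁ (s≤s k₀≤n) = begin
    (foldTo (g ∘ σ′) n ⊕ g (σ′ (suc n))) ⊕ g (σ k₀)
      ≡⟨ cong (λ z → (foldTo (g ∘ σ′) n ⊕ g z) ⊕ g (σ k₀)) (update-≢ σ k₀ v (ℕₚ.<⇒≢ (s≤s k₀≤n) ∘ sym)) ⟩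
    (foldTo (g ∘ σ′) n ⊕ g (σ (suc n))) ⊕ g (σ k₀)  ≡⟨ swapʳ _ _ _ ⟩
    (foldTo (g ∘ σ′) n ⊕ g (σ k₀)) ⊕ g (σ (suc n))  ≡⟨ cong (_⊕ g (σ (suc n))) (foldTo-update g σ k₀ v n 1≤k₀ k₀≤n) ⟩
    (foldTo (g ∘ σ) n ⊕ g v) ⊕ g (σ (suc n))        ≡⟨ swapʳ _ _ _ ⟩
    (foldTo (g ∘ σ) n ⊕ g (σ (suc n))) ⊕ g v        ∎
    where open ≡-Reasoning
          σ′ : ℕ → ℕ
          σ′ = update σ k₀ v

  foldTo-permute : ∀ (g : ℕ → A) σ n → InjectiveInto σ n n → foldTo (g ∘ σ) n ≡ foldTo g n
  foldTo-permute g σ zero    _   = refl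
  foldTo-permute g σ (suc n) inj with preimage σ (suc n) (suc n)
  ... | inj₂ avoid = ⊥-elim (pigeonhole σ ℕₚ.≤-refl (InjectiveInto-shrink inj avoid))
  ... | inj₁ (k₀ , 1≤k₀ , k₀≤ , σk₀) with ℕₚ.m≤n⇒m<n∨m≡n k₀≤
  ...   | inj₂ refl = begin
    foldTo (g ∘ σ) n ⊕ g (σ (suc n))
      ≡⟨ cong₂ (λ a b → a ⊕ g b)
               (foldTo-cong n (λ k _ k≤n → cong g (sym (update-≢ σ k₀ _ (ℕₚ.<⇒≢ (s≤s k≤n)))))) σk₀ ⟩
    foldTo (g ∘ σ′) n ⊕ g (suc n)  ≡⟨ cong (_⊕ g (suc n)) (foldTo-permute g σ′ n (InjectiveInto-swap inj k₀ 1≤k₀ k₀≤ σk₀)) ⟩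
    foldTo g n ⊕ g (suc n)         ∎
    where open ≡-Reasoning
          σ′ : ℕ → ℕ
          σ′ = update σ k₀ (σ (suc n))
  ...   | inj₁ (s≤s k₀≤n) = begin
    foldTo (g ∘ σ) n ⊕ g (σ (suc n))  ≡⟨ foldTo-update g σ k₀ (σ (suc n)) n 1≤k₀ k₀≤n ⟨
    foldTo (g ∘ σ′) n ⊕ g (σ k₀)
      ≡⟨ cong₂ (λ a b → a ⊕ g b) (foldTo-permute g σ′ n (InjectiveInto-swap inj k₀ 1≤k₀ k₀≤ σk₀)) σk₀ ⟩
    foldTo g n ⊕ g (suc n)            ∎
    where open ≡-Reasoning
          σ′ : ℕ → ℕ
          σ′ = update σ k₀ (σ (suc n))

open Fold _+_ 0 ℕₚ.+-assoc ℕₚ.+-comm public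
  using () renaming (foldTo to sumTo; foldTo-cong to sumTo-cong; foldTo-permute to sumTo-permute)
open Fold _*_ 1 ℕₚ.*-assoc ℕₚ.*-comm public
  using () renaming (foldTo to prodTo; foldTo-permute to prodTo-permute)
open Fold ℤ._*_ (+ 1) ℤₚ.*-assoc ℤₚ.*-comm public
  using () renaming (foldTo to prodToℤ)

sumTo-distrib-+ : ∀ f g n → sumTo (λ k → f k + g k) n ≡ sumTo f n + sumTo g n
sumTo-distrib-+ f g zero    = refl
sumTo-distrib-+ f g (suc n) = trans (cong (_+ (f (suc n) + g (suc n))) (sumTo-distrib-+ f g n))
                                    (identity (sumTo f n) (sumTo g n) (f (suc n)) (g (suc n)))
  where identity : ∀ a b c d → a + b + (c + d) ≡ a + c + (b + d)
        identity = solve-∀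

sumTo-*ˡ : ∀ c f n → sumTo (λ k → c * f k) n ≡ c * sumTo f n
sumTo-*ˡ c f zero    = sym (ℕₚ.*-zeroʳ c)
sumTo-*ˡ c f (suc n) = trans (cong (_+ c * f (suc n)) (sumTo-*ˡ c f n))
                             (sym (ℕₚ.*-distribˡ-+ c (sumTo f n) (f (suc n))))

sumTo-*ʳ : ∀ c f n → sumTo (λ k → f k * c) n ≡ sumTo f n * c
sumTo-*ʳ c f n = trans (sumTo-cong n (λ k _ _ → ℕₚ.*-comm (f k) c))
                       (trans (sumTo-*ˡ c f n) (ℕₚ.*-comm c (sumTo f n)))

sumTo-const : ∀ c n → sumTo (λ _ → c) n ≡ n * c
sumTo-const c zero    = refl
sumTo-const c (suc n) = trans (cong (_+ c) (sumTo-const c n)) (ℕₚ.+-comm (n * c) c)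

sumTo-comm : ∀ (F : ℕ → ℕ → ℕ) m n → sumTo (λ j → sumTo (λ k → F k j) m) n ≡ sumTo (λ k → sumTo (λ j → F k j) n) m
sumTo-comm F m zero    = sym (trans (sumTo-cong m (λ _ _ _ → refl)) (trans (sumTo-const 0 m) (ℕₚ.*-zeroʳ m)))
sumTo-comm F m (suc n) = trans (cong (_+ sumTo (λ k → F k (suc n)) m) (sumTo-comm F m n))
                               (sym (sumTo-distrib-+ (λ k → sumTo (λ j → F k j) n) (λ k → F k (suc n)) m))

prodTo-*ˡ : ∀ a n → prodTo (λ k → a * k) n ≡ a ^ n * prodTo (λ k → k) n
prodTo-*ˡ a zero    = refl
prodTo-*ˡ a (suc n) = trans (cong (_* (a * suc n)) (prodTo-*ˡ a n)) (identity (a ^ n) (prodTo (λ k → k) n) a (suc n))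
  where identity : ∀ x y a b → x * y * (a * b) ≡ a * x * (y * b)
        identity = solve-∀

prodToℤ-mod : ∀ {m f g} n → (∀ k → 1 ≤ k → k ≤ n → f k ≡ g k [mod m ]) → prodToℤ f n ≡ prodToℤ g n [mod m ]
prodToℤ-mod zero    f≡g = mod-refl
prodToℤ-mod (suc n) f≡g = mod-* (prodToℤ-mod n (λ k 1≤k k≤n → f≡g k 1≤k (ℕₚ.m≤n⇒m≤1+n k≤n))) (f≡g (suc n) (s≤s z≤n) ℕₚ.≤-refl)

prodToℤ-distrib-* : ∀ f g n → prodToℤ (λ k → f k ℤ.* g k) n ≡ prodToℤ f n ℤ.* prodToℤ g n
prodToℤ-distrib-* f g zero    = refl
prodToℤ-distrib-* f g (suc n) = trans (cong (ℤ._* (f (suc n) ℤ.* g (suc n))) (prodToℤ-distrib-* f g n))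
                                      (identity (prodToℤ f n) (prodToℤ g n) (f (suc n)) (g (suc n)))
  where identity : ∀ a b c d → a ℤ.* b ℤ.* (c ℤ.* d) ≡ a ℤ.* c ℤ.* (b ℤ.* d)
        identity = ℤRing.solve-∀

prodToℤ-+ : ∀ f n → prodToℤ (λ k → + f k) n ≡ + prodTo f n
prodToℤ-+ f zero    = refl
prodToℤ-+ f (suc n) = trans (cong (ℤ._* + f (suc n)) (prodToℤ-+ f n)) (sym (ℤₚ.pos-* (prodTo f n) (f (suc n))))

prodToℤ-sign : ∀ f n → prodToℤ (λ k → -1^ f k) n ≡ -1^ sumTo f n
prodToℤ-sign f zero    = refl
prodToℤ-sign f (suc n) = trans (cong (ℤ._* -1^ f (suc n)) (prodToℤ-sign f n)) (sym (-1^-+ (sumTo f n) (f (suc n))))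

prime∤prodTo : ∀ {p} f n → Prime p → (∀ k → 1 ≤ k → k ≤ n → ¬ p ∣ f k) → ¬ p ∣ prodTo f n
prime∤prodTo f zero    p-prime _    = prime∤1 p-prime
prime∤prodTo f (suc n) p-prime p∤f p∣∏ with euclidsLemma (prodTo f n) (f (suc n)) p-prime p∣∏
... | inj₁ p∣∏′ = prime∤prodTo f n p-prime (λ k 1≤k k≤n → p∤f k 1≤k (ℕₚ.m≤n⇒m≤1+n k≤n)) p∣∏′
... | inj₂ p∣fn = p∤f (suc n) (s≤s z≤n) ℕₚ.≤-refl p∣fn

-- Gauss's lemma

𝟙 : ∀ {A : Set} → Dec A → ℕ
𝟙 (yes _) = 1
𝟙 (no _)  = 0

-- For P = 2h + 1, μ a h counts the k ≤ h with a k ≡ -x (mod P) for some 1 ≤ x ≤ h.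
μ : ℕ → ℕ → ℕ
μ a h = sumTo (λ k → 𝟙 (h <? (a * k) % suc (2 * h))) h

h<2h+1 : ∀ h → h < suc (2 * h)
h<2h+1 h = s≤s (ℕₚ.m≤m+n h (h + 0))

module LeastAbsoluteResidue (h : ℕ) where

  P : ℕ
  P = suc (2 * h)

  ∣res∣ : ∀ {x} → Dec (h < x) → ℕ
  ∣res∣ {x} (yes _) = P ∸ x
  ∣res∣ {x} (no _)  = x

  ∣res∣-bounds : ∀ {x} (d : Dec (h < x)) → 1 ≤ x → x < P → 1 ≤ ∣res∣ d × ∣res∣ d ≤ h
  ∣res∣-bounds {x} (yes h<x) _ x<P = ℕₚ.m<n⇒0<n∸m x<P , ℕₚ.≤-trans (ℕₚ.∸-monoʳ-≤ P h<x) (ℕₚ.≤-reflexive (P∸[1+h] h))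
    where P∸[1+h] : ∀ h → suc (2 * h) ∸ suc h ≡ h
          P∸[1+h] h = trans (cong (_∸ suc h) (identity h)) (ℕₚ.m+n∸n≡m h (suc h))
            where identity : ∀ h → suc (2 * h) ≡ h + suc h
                  identity = solve-∀
  ∣res∣-bounds {x} (no ¬h<x) 1≤x _ = 1≤x , ℕₚ.≮⇒≥ ¬h<x

  ∣res∣-mod : ∀ {x} (d : Dec (h < x)) → x ≤ P → + x ≡ -1^ 𝟙 d ℤ.* + ∣res∣ d [mod P ]
  ∣res∣-mod {x} (yes _) x≤P = mod-sym (subst (_≡ + x [mod P ]) (identity x≤P) (+-multiple-mod (+ x) (ℤ.- + 1)))
    where
    identity : x ≤ P → + x ℤ.+ ℤ.- + 1 ℤ.* + P ≡ -1^ 1 ℤ.* + (P ∸ x)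
    identity x≤P = begin
      + x ℤ.+ ℤ.- + 1 ℤ.* + P            ≡⟨ cong (λ z → + x ℤ.+ ℤ.- + 1 ℤ.* + z) (ℕₚ.m∸n+n≡m x≤P) ⟨
      + x ℤ.+ ℤ.- + 1 ℤ.* + (P ∸ x + x)  ≡⟨ cong (λ z → + x ℤ.+ ℤ.- + 1 ℤ.* z) (ℤₚ.pos-+ (P ∸ x) x) ⟩
      + x ℤ.+ ℤ.- + 1 ℤ.* (+ (P ∸ x) ℤ.+ + x)  ≡⟨ ring (+ x) (+ (P ∸ x)) ⟩
      -1^ 1 ℤ.* + (P ∸ x)                ∎
      where open ≡-Reasoning
            ring : ∀ a b → a ℤ.+ ℤ.- + 1 ℤ.* (b ℤ.+ a) ≡ ℤ.- + 1 ℤ.* b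
            ring = ℤRing.solve-∀
  ∣res∣-mod {x} (no _) _ = mod-reflexive (sym (ℤₚ.*-identityˡ (+ x)))

  ∣res∣-+ : ∀ {x} (d : Dec (h < x)) → x ≤ P → x + 2 * (∣res∣ d * 𝟙 d) ≡ ∣res∣ d + P * 𝟙 d
  ∣res∣-+ {x} (yes _) x≤P = begin
    x + 2 * ((P ∸ x) * 1)        ≡⟨ identity x (P ∸ x) ⟩
    (P ∸ x) + (x + (P ∸ x)) * 1  ≡⟨ cong (λ z → (P ∸ x) + z * 1) (ℕₚ.m+[n∸m]≡n x≤P) ⟩
    (P ∸ x) + P * 1              ∎
    where open ≡-Reasoning
          identity : ∀ a b → a + 2 * (b * 1) ≡ b + (a + b) * 1
          identity = solve-∀
  ∣res∣-+ {x} (no _) _ = identity x P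
    where identity : ∀ x P → x + 2 * (x * 0) ≡ x + P * 0
          identity = solve-∀

  ∣res∣-injective : ∀ {x y} (dx : Dec (h < x)) (dy : Dec (h < y)) → x ≤ P → y ≤ P →
                    ∣res∣ dx ≡ ∣res∣ dy → x ≡ y ⊎ x + y ≡ P
  ∣res∣-injective (yes _) (yes _) x≤P y≤P e = inj₁ (ℕₚ.∸-cancelˡ-≡ x≤P y≤P e)
  ∣res∣-injective {x} (yes _) (no _) x≤P _ e = inj₂ (trans (cong (_+_ x) (sym e)) (ℕₚ.m+[n∸m]≡n x≤P))
  ∣res∣-injective {y = y} (no _) (yes _) _ y≤P e = inj₂ (trans (cong (_+ y) e) (ℕₚ.m∸n+n≡m y≤P))
  ∣res∣-injective (no _) (no _) _ _ e = inj₁ e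

module GaussLemma (h a : ℕ) (P-prime : Prime (suc (2 * h))) (P∤a : ¬ suc (2 * h) ∣ a) where
  open LeastAbsoluteResidue h

  r : ℕ → ℕ
  r k = (a * k) % P

  negative? : ∀ k → Dec (h < r k)
  negative? k = h <? r k

  s : ℕ → ℕ
  s k = ∣res∣ (negative? k)

  r<P : ∀ k → r k < P
  r<P k = ℕ÷.m%n<n (a * k) P

  r≤P : ∀ k → r k ≤ P
  r≤P k = ℕₚ.<⇒≤ (r<P k)

  a*k≡r : ∀ k → + (a * k) ≡ + r k [mod P ]
  a*k≡r k = subst (_≡ + r k [mod P ]) (cong +_ (sym (ℕ÷.m≡m%n+[m/n]*n (a * k) P))) (begin
    + (r k + a * k / P * P)          ≡⟨ ℤₚ.pos-+ (r k) (a * k / P * P) ⟩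
    + r k ℤ.+ + (a * k / P * P)      ≡⟨ cong (ℤ._+_ (+ r k)) (ℤₚ.pos-* (a * k / P) P) ⟩
    + r k ℤ.+ + (a * k / P) ℤ.* + P  ≈⟨ +-multiple-mod (+ r k) (+ (a * k / P)) ⟩
    + r k                            ∎)
    where open ≡-mod-Reasoning P

  P∣a*⇒P∣ : ∀ {n} → P ∣ a * n → P ∣ n
  P∣a*⇒P∣ {n} P∣an = [ ⊥-elim ∘ P∤a , id ]′ (euclidsLemma a n P-prime P∣an)

  1≤r : ∀ k → 1 ≤ k → k ≤ h → 1 ≤ r k
  1≤r k 1≤k k≤h = ℕₚ.n≢0⇒n>0 (λ rk≡0 →
    prime∤-small 1≤k (ℕₚ.≤-<-trans k≤h (h<2h+1 h)) (P∣a*⇒P∣ (m%n≡0⇒n∣m (a * k) P rk≡0)))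

  a*-injective : ∀ j k → j < P → k < P → + (a * j) ≡ + (a * k) [mod P ] → j ≡ k
  a*-injective j k j<P k<P aj≡ak = mod⇒≡ j k j<P k<P (mod-cancelʳ (+ a) P-prime (P∤a ∘ ℤ÷.∣⇒∣ᵤ) (begin
    + j ℤ.* + a  ≡⟨ trans (sym (ℤₚ.pos-* j a)) (cong +_ (ℕₚ.*-comm j a)) ⟩
    + (a * j)    ≈⟨ aj≡ak ⟩
    + (a * k)    ≡⟨ trans (cong +_ (ℕₚ.*-comm a k)) (ℤₚ.pos-* k a) ⟩
    + k ℤ.* + a  ∎))
    where open ≡-mod-Reasoning P

  r-injective : ∀ j k → j ≤ h → k ≤ h → r j ≡ r k → j ≡ k
  r-injective j k j≤h k≤h rj≡rk = a*-injective j k (ℕₚ.≤-<-trans j≤h (h<2h+1 h)) (ℕₚ.≤-<-trans k≤h (h<2h+1 h)) (begin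
    + (a * j)  ≈⟨ a*k≡r j ⟩
    + r j      ≡⟨ cong +_ rj≡rk ⟩
    + r k      ≈⟨ a*k≡r k ⟨
    + (a * k)  ∎)
    where open ≡-mod-Reasoning P

  r+r≢P : ∀ j k → 1 ≤ j → j ≤ h → k ≤ h → r j + r k ≢ P
  r+r≢P j k 1≤j j≤h k≤h rj+rk≡P = prime∤-small (ℕₚ.≤-trans 1≤j (ℕₚ.m≤m+n j k)) j+k<P (P∣a*⇒P∣ (ℤ÷.∣⇒∣ᵤ (mod-0⇒∣ (begin
    + (a * (j + k))          ≡⟨ cong +_ (ℕₚ.*-distribˡ-+ a j k) ⟩
    + (a * j + a * k)        ≡⟨ ℤₚ.pos-+ (a * j) (a * k) ⟩
    + (a * j) ℤ.+ + (a * k)  ≈⟨ mod-+ (a*k≡r j) (a*k≡r k) ⟩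
    + r j ℤ.+ + r k          ≡⟨ ℤₚ.pos-+ (r j) (r k) ⟨
    + (r j + r k)            ≡⟨ cong +_ rj+rk≡P ⟩
    + P                      ≈⟨ self≡0[mod] ⟩
    + 0                      ∎))))
    where
    open ≡-mod-Reasoning P
    j+k<P : j + k < P
    j+k<P = s≤s (ℕₚ.+-mono-≤ j≤h (ℕₚ.≤-trans k≤h (ℕₚ.m≤m+n h 0)))

  s-injective : InjectiveInto s h h
  s-injective = record
    { bounded   = λ k 1≤k k≤h → ∣res∣-bounds (negative? k) (1≤r k 1≤k k≤h) (r<P k)
    ; injective = λ j k 1≤j j≤h _ k≤h sj≡sk →
        [ r-injective j k j≤h k≤h , ⊥-elim ∘ r+r≢P j k 1≤j j≤h k≤h ]′
        (∣res∣-injective (negative? j) (negative? k) (r≤P j) (r≤P k) sj≡sk)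
    }

  a*k≡±s : ∀ k → + (a * k) ≡ -1^ 𝟙 (negative? k) ℤ.* + s k [mod P ]
  a*k≡±s k = mod-trans (a*k≡r k) (∣res∣-mod (negative? k) (r≤P k))

  gauss : (+ a) ℤ.^ h ≡ -1^ μ a h [mod P ]
  gauss = mod-cancelʳ (+ h!) P-prime (P∤h! ∘ ℤ÷.∣⇒∣ᵤ) (begin
    (+ a) ℤ.^ h ℤ.* + h!                          ≡⟨ cong (ℤ._* + h!) (pos-^ a h) ⟩
    + (a ^ h) ℤ.* + h!                            ≡⟨ ℤₚ.pos-* (a ^ h) h! ⟨
    + (a ^ h * h!)                                ≡⟨ cong +_ (prodTo-*ˡ a h) ⟨
    + prodTo (λ k → a * k) h                      ≡⟨ prodToℤ-+ (λ k → a * k) h ⟨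
    prodToℤ (λ k → + (a * k)) h                   ≈⟨ prodToℤ-mod h (λ k _ _ → a*k≡±s k) ⟩
    prodToℤ (λ k → -1^ 𝟙 (negative? k) ℤ.* + s k) h
      ≡⟨ prodToℤ-distrib-* (λ k → -1^ 𝟙 (negative? k)) (λ k → + s k) h ⟩
    prodToℤ (λ k → -1^ 𝟙 (negative? k)) h ℤ.* prodToℤ (λ k → + s k) h
      ≡⟨ cong₂ ℤ._*_ (prodToℤ-sign (λ k → 𝟙 (negative? k)) h) (prodToℤ-+ s h) ⟩
    -1^ μ a h ℤ.* + prodTo s h                    ≡⟨ cong (λ z → -1^ μ a h ℤ.* + z) (prodTo-permute (λ k → k) s h s-injective) ⟩
    -1^ μ a h ℤ.* + h!                            ∎)
    where
    open ≡-mod-Reasoning P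
    h! : ℕ
    h! = prodTo (λ k → k) h
    P∤h! : ¬ P ∣ h!
    P∤h! = prime∤prodTo (λ k → k) h P-prime (λ k 1≤k k≤h → prime∤-small 1≤k (ℕₚ.≤-<-trans k≤h (h<2h+1 h)))

gauss-lemma : ∀ h a → Prime (suc (2 * h)) → ¬ suc (2 * h) ∣ a → (+ a) ℤ.^ h ≡ -1^ μ a h [mod suc (2 * h) ]
gauss-lemma h a P-prime P∤a = GaussLemma.gauss h a P-prime P∤a

-- Eisenstein's lemma

T : ℕ → ℕ → ℕ
T a h = sumTo (λ k → (a * k) / suc (2 * h)) h

module Eisenstein (h α : ℕ) (P-prime : Prime (suc (2 * h))) (P∤a : ¬ suc (2 * h) ∣ suc (2 * α)) where
  open LeastAbsoluteResidue h
  open GaussLemma h (suc (2 * α)) P-prime P∤a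

  a : ℕ
  a = suc (2 * α)
  S : ℕ
  S = sumTo (λ k → k) h
  X : ℕ
  X = sumTo (λ k → s k * 𝟙 (negative? k)) h

  a*S≡ : a * S ≡ sumTo r h + T a h * P
  a*S≡ = begin
    a * S                                   ≡⟨ sumTo-*ˡ a (λ k → k) h ⟨
    sumTo (λ k → a * k) h                   ≡⟨ sumTo-cong h (λ k _ _ → ℕ÷.m≡m%n+[m/n]*n (a * k) P) ⟩
    sumTo (λ k → r k + a * k / P * P) h     ≡⟨ sumTo-distrib-+ r (λ k → a * k / P * P) h ⟩
    sumTo r h + sumTo (λ k → a * k / P * P) h  ≡⟨ cong (_+_ (sumTo r h)) (sumTo-*ʳ P (λ k → a * k / P) h) ⟩
    sumTo r h + T a h * P                   ∎
    where open ≡-Reasoning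

  sum-r≡ : sumTo r h + 2 * X ≡ S + P * μ a h
  sum-r≡ = begin
    sumTo r h + 2 * X                                    ≡⟨ cong (_+_ (sumTo r h)) (sumTo-*ˡ 2 _ h) ⟨
    sumTo r h + sumTo (λ k → 2 * (s k * 𝟙 (negative? k))) h  ≡⟨ sumTo-distrib-+ r _ h ⟨
    sumTo (λ k → r k + 2 * (s k * 𝟙 (negative? k))) h   ≡⟨ sumTo-cong h (λ k _ _ → ∣res∣-+ (negative? k) (r≤P k)) ⟩
    sumTo (λ k → s k + P * 𝟙 (negative? k)) h           ≡⟨ sumTo-distrib-+ s _ h ⟩
    sumTo s h + sumTo (λ k → P * 𝟙 (negative? k)) h     ≡⟨ cong₂ _+_ (sumTo-permute (λ k → k) s h s-injective) (sumTo-*ˡ P _ h) ⟩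
    S + P * μ a h                                        ∎
    where open ≡-Reasoning

  -- Reduce a S = Σ r + T P modulo 2, where a and P are odd and Σ r ≡ S + μ (mod 2).
  eisenstein : -1^ T a h ≡ -1^ μ a h
  eisenstein = -1^-parity (T a h) (μ a h) {c = h * T a h + h * μ a h} {d = α * S + X}
    (ℕₚ.+-cancelʳ-≡ S _ _ (begin
      T a h + μ a h + 2 * (h * T a h + h * μ a h) + S  ≡⟨ identity₁ (T a h) (μ a h) h S ⟩
      T a h * P + (S + P * μ a h)                      ≡⟨ cong (_+_ (T a h * P)) sum-r≡ ⟨
      T a h * P + (sumTo r h + 2 * X)                  ≡⟨ identity₂ (T a h * P) (sumTo r h) (2 * X) ⟩
      (sumTo r h + T a h * P) + 2 * X                  ≡⟨ cong (_+ 2 * X) a*S≡ ⟨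
      a * S + 2 * X                                    ≡⟨ identity₃ α S X ⟩
      2 * (α * S + X) + S                              ∎))
    where
    open ≡-Reasoning
    identity₁ : ∀ t m h S → t + m + 2 * (h * t + h * m) + S ≡ t * suc (2 * h) + (S + suc (2 * h) * m)
    identity₁ = solve-∀
    identity₂ : ∀ u v w → u + (v + w) ≡ (v + u) + w
    identity₂ = solve-∀
    identity₃ : ∀ α S X → suc (2 * α) * S + 2 * X ≡ 2 * (α * S + X) + S
    identity₃ = solve-∀

eisenstein : ∀ h α → Prime (suc (2 * h)) → ¬ suc (2 * h) ∣ suc (2 * α) → -1^ T (suc (2 * α)) h ≡ -1^ μ (suc (2 * α)) h
eisenstein h α P-prime P∤a = Eisenstein.eisenstein h α P-prime P∤a

-- Lattice points under the diagonal of a rectangle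

quotient-unique : ∀ x m q .{{_ : NonZero m}} → q * m ≤ x → x < suc q * m → x / m ≡ q
quotient-unique x m q lo hi with ℕₚ.<-cmp (x / m) q
... | tri≈ _ x/m≡q _ = x/m≡q
... | tri< x/m<q _ _ = ⊥-elim (ℕₚ.<⇒≱ (begin-strict
  x                  ≡⟨ ℕ÷.m≡m%n+[m/n]*n x m ⟩
  x % m + x / m * m  <⟨ ℕₚ.+-monoˡ-< (x / m * m) (ℕ÷.m%n<n x m) ⟩
  suc (x / m) * m    ≤⟨ ℕₚ.*-monoˡ-≤ m x/m<q ⟩
  q * m              ∎) lo)
  where open ℕₚ.≤-Reasoning
... | tri> _ _ q<x/m = ⊥-elim (ℕₚ.<⇒≱ hi (begin
  suc q * m          ≤⟨ ℕₚ.*-monoˡ-≤ m q<x/m ⟩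
  x / m * m          ≤⟨ ℕ÷.m/n*n≤m x m ⟩
  x                  ∎))
  where open ℕₚ.≤-Reasoning

/-count : ∀ x m H .{{_ : NonZero m}} → x < suc H * m → x / m ≡ sumTo (λ j → 𝟙 (j * m ≤? x)) H
/-count x m zero    x<m = ℕ÷.m<n⇒m/n≡0 (subst (x <_) (ℕₚ.+-identityʳ m) x<m)
/-count x m (suc H) x<  with suc H * m ≤? x
... | no  ¬Hm≤x = trans (/-count x m H (ℕₚ.≰⇒> ¬Hm≤x)) (sym (ℕₚ.+-identityʳ _))
... | yes Hm≤x  = trans (quotient-unique x m (suc H) Hm≤x x<)
                        (trans (ℕₚ.+-comm 1 H) (cong (_+ 1) (sym (count-all H (ℕₚ.≤-trans (ℕₚ.*-monoˡ-≤ m (ℕₚ.n≤1+n H)) Hm≤x)))))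
  where
  count-all : ∀ H → H * m ≤ x → sumTo (λ j → 𝟙 (j * m ≤? x)) H ≡ H
  count-all zero    _ = refl
  count-all (suc H) Hm≤x with suc H * m ≤? x
  ... | yes _ = trans (cong (_+ 1) (count-all H (ℕₚ.≤-trans (ℕₚ.*-monoˡ-≤ m (ℕₚ.n≤1+n H)) Hm≤x))) (ℕₚ.+-comm H 1)
  ... | no ¬Hm≤x = ⊥-elim (¬Hm≤x Hm≤x)

lattice-count : ∀ h β → (∀ j k → 1 ≤ j → j ≤ β → 1 ≤ k → k ≤ h → suc (2 * h) * j ≢ suc (2 * β) * k) →
                T (suc (2 * β)) h + T (suc (2 * h)) β ≡ h * β
lattice-count h β off-diagonal = begin
  T b h + T P β
    ≡⟨ cong₂ _+_ (sumTo-cong h (λ k _ k≤h → /-count (b * k) P β (row-bound h β k k≤h)))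
                 (sumTo-cong β (λ j _ j≤β → /-count (P * j) b h (row-bound β h j j≤β))) ⟩
  sumTo (λ k → sumTo (λ j → below j k) β) h + sumTo (λ j → sumTo (λ k → above j k) h) β
    ≡⟨ cong (_+_ (sumTo (λ k → sumTo (λ j → below j k) β) h)) (sumTo-comm (λ k j → above j k) h β) ⟩
  sumTo (λ k → sumTo (λ j → below j k) β) h + sumTo (λ k → sumTo (λ j → above j k) β) h
    ≡⟨ sumTo-distrib-+ _ _ h ⟨
  sumTo (λ k → sumTo (λ j → below j k) β + sumTo (λ j → above j k) β) h
    ≡⟨ sumTo-cong h (λ k _ _ → sumTo-distrib-+ _ _ β) ⟨
  sumTo (λ k → sumTo (λ j → below j k + above j k) β) h
    ≡⟨ sumTo-cong h (λ k 1≤k k≤h → sumTo-cong β (λ j 1≤j j≤β → one-side j k (off-diagonal j k 1≤j j≤β 1≤k k≤h))) ⟩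
  sumTo (λ k → sumTo (λ j → 1) β) h
    ≡⟨ sumTo-cong h (λ k _ _ → trans (sumTo-const 1 β) (ℕₚ.*-identityʳ β)) ⟩
  sumTo (λ k → β) h   ≡⟨ sumTo-const β h ⟩
  h * β               ∎
  where
  open ≡-Reasoning
  P : ℕ
  P = suc (2 * h)
  b : ℕ
  b = suc (2 * β)
  below above : ℕ → ℕ → ℕ
  below j k = 𝟙 (j * P ≤? b * k)
  above j k = 𝟙 (k * b ≤? P * j)
  row-bound : ∀ h β k → k ≤ h → suc (2 * β) * k < suc β * suc (2 * h)
  row-bound h β k k≤h = ℕₚ.≤-<-trans (ℕₚ.*-monoʳ-≤ (suc (2 * β)) k≤h)
    (subst (suc (2 * β) * h <_) (sym (identity h β)) (ℕₚ.m<m+n _ (s≤s z≤n)))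
    where identity : ∀ h β → suc β * suc (2 * h) ≡ suc (2 * β) * h + suc (β + h)
          identity = solve-∀
  one-side : ∀ j k → P * j ≢ b * k → below j k + above j k ≡ 1
  one-side j k ≢ with j * P ≤? b * k | k * b ≤? P * j
  ... | yes jP≤bk | yes kb≤Pj = ⊥-elim (≢ (ℕₚ.≤-antisym (subst (_≤ b * k) (ℕₚ.*-comm j P) jP≤bk)
                                                        (subst (_≤ P * j) (ℕₚ.*-comm k b) kb≤Pj)))
  ... | yes _ | no _  = refl
  ... | no _  | yes _ = refl
  ... | no jP≰bk | no kb≰Pj = ⊥-elim (jP≰bk (subst₂ _≤_ (ℕₚ.*-comm P j) (ℕₚ.*-comm k b) (ℕₚ.<⇒≤ (ℕₚ.≰⇒> kb≰Pj))))

-- Quadratic reciprocity and the supplementary laws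

off-diagonal : ∀ h b j k → Prime (suc (2 * h)) → ¬ suc (2 * h) ∣ b → 1 ≤ k → k ≤ h → suc (2 * h) * j ≢ b * k
off-diagonal h b j k P-prime P∤b 1≤k k≤h Pj≡bk with euclidsLemma b k P-prime (divides j (trans (sym Pj≡bk) (ℕₚ.*-comm _ j)))
... | inj₁ P∣b = P∤b P∣b
... | inj₂ P∣k = prime∤-small 1≤k (ℕₚ.≤-<-trans k≤h (h<2h+1 h)) P∣k

μ-odd : ∀ h β → Prime (suc (2 * h)) → ¬ suc (2 * h) ∣ suc (2 * β) →
        -1^ μ (suc (2 * β)) h ≡ -1^ (h * β) ℤ.* -1^ T (suc (2 * h)) β
μ-odd h β P-prime P∤b = trans (sym (eisenstein h β P-prime P∤b))
  (-1^-difference (T (suc (2 * β)) h) (T (suc (2 * h)) β)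
    (lattice-count h β (λ j k _ _ 1≤k k≤h → off-diagonal h (suc (2 * β)) j k P-prime P∤b 1≤k k≤h)))

quadratic-reciprocity : ∀ h l → Prime (suc (2 * h)) → Prime (suc (2 * l)) →
                        ¬ suc (2 * h) ∣ suc (2 * l) → ¬ suc (2 * l) ∣ suc (2 * h) →
                        -1^ μ (suc (2 * l)) h ≡ -1^ (h * l) ℤ.* -1^ μ (suc (2 * h)) l
quadratic-reciprocity h l P-prime ℓ-prime P∤ℓ ℓ∤P =
  trans (μ-odd h l P-prime P∤ℓ) (cong (-1^ (h * l) ℤ.*_) (eisenstein l h ℓ-prime ℓ∤P))

fermat : ∀ h t → Prime (suc (2 * h)) → ¬ suc (2 * h) ∣ t → (+ t) ℤ.^ h ℤ.* (+ t) ℤ.^ h ≡ + 1 [mod suc (2 * h) ]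
fermat h t P-prime P∤t = mod-trans (mod-* (gauss-lemma h t P-prime P∤t) (gauss-lemma h t P-prime P∤t))
                                   (mod-reflexive (-1^-square (μ t h)))

μ-cong : ∀ x y h → x % suc (2 * h) ≡ y % suc (2 * h) → μ x h ≡ μ y h
μ-cong x y h x≡y = sumTo-cong h (λ k _ _ → cong (λ z → 𝟙 (h <? z)) (xk≡yk k))
  where
  P : ℕ
  P = suc (2 * h)
  xk≡yk : ∀ k → (x * k) % P ≡ (y * k) % P
  xk≡yk k = trans (ℕ÷.%-distribˡ-* x k P) (trans (cong (λ z → (z * (k % P)) % P) x≡y) (sym (ℕ÷.%-distribˡ-* y k P)))

μ-1 : ∀ h → μ 1 h ≡ 0
μ-1 h = trans (sumTo-cong h (λ k _ k≤h → not-above k k≤h)) (trans (sumTo-const 0 h) (ℕₚ.*-zeroʳ h))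
  where
  not-above : ∀ k → k ≤ h → 𝟙 (h <? (1 * k) % suc (2 * h)) ≡ 0
  not-above k k≤h with h <? (1 * k) % suc (2 * h)
  ... | no _     = refl
  ... | yes h<k% = ⊥-elim (ℕₚ.<⇒≱ h<k% (ℕₚ.≤-trans (ℕₚ.≤-reflexive k%≡k) k≤h))
    where k%≡k : (1 * k) % suc (2 * h) ≡ k
          k%≡k = trans (cong (_% suc (2 * h)) (ℕₚ.*-identityˡ k)) (ℕ÷.m<n⇒m%n≡m (ℕₚ.≤-<-trans k≤h (h<2h+1 h)))

gauss-sum : ∀ n → sumTo (λ k → k) n * 2 ≡ n * suc n
gauss-sum zero    = refl
gauss-sum (suc n) = trans (ℕₚ.*-distribʳ-+ 2 (sumTo (λ k → k) n) (suc n))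
                          (trans (cong (_+ suc n * 2) (gauss-sum n)) (identity n))
  where identity : ∀ n → n * suc n + suc n * 2 ≡ suc n * suc (suc n)
        identity = solve-∀

-- μ 2 h = μ (P + 2) h, and Eisenstein's lemma applies to the odd P + 2, with ⌊(P + 2) k / P⌋ = k.
second-supplement : ∀ h → 1 ≤ h → Prime (suc (2 * h)) → (+ 2) ℤ.^ h ≡ -1^ sumTo (λ k → k) h [mod suc (2 * h) ]
second-supplement h 1≤h P-prime = mod-trans (gauss-lemma h 2 P-prime P∤2) (mod-reflexive (begin
  -1^ μ 2 h                 ≡⟨ cong -1^_ (μ-cong 2 (2 + P) h (sym (ℕ÷.[m+n]%n≡m%n 2 P))) ⟩
  -1^ μ (2 + P) h           ≡⟨ cong (λ z → -1^ μ z h) P+2≡ ⟩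
  -1^ μ (suc (2 * suc h)) h ≡⟨ eisenstein h (suc h) P-prime (subst (λ z → ¬ P ∣ z) P+2≡ P∤P+2) ⟨
  -1^ T (suc (2 * suc h)) h ≡⟨ cong -1^_ (sumTo-cong h (λ k _ k≤h → quotient-unique _ P k (lower k) (upper k k≤h))) ⟩
  -1^ sumTo (λ k → k) h     ∎))
  where
  open ≡-Reasoning
  P : ℕ
  P = suc (2 * h)
  P≥3 : 3 ≤ P
  P≥3 = s≤s (ℕₚ.*-monoʳ-≤ 2 1≤h)
  P∤2 : ¬ P ∣ 2
  P∤2 = prime∤-small (s≤s z≤n) P≥3
  P∤P+2 : ¬ P ∣ 2 + P
  P∤P+2 P∣P+2 = P∤2 (∣m+n∣m⇒∣n (subst (P ∣_) (ℕₚ.+-comm 2 P) P∣P+2) ∣-refl)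
  P+2≡ : 2 + P ≡ suc (2 * suc h)
  P+2≡ = identity h
    where identity : ∀ h → 2 + suc (2 * h) ≡ suc (2 * suc h)
          identity = solve-∀
  lower : ∀ k → k * P ≤ suc (2 * suc h) * k
  lower k = subst (k * P ≤_) (identity k h) (ℕₚ.m≤n+m (k * P) (2 * k))
    where identity : ∀ k h → 2 * k + k * suc (2 * h) ≡ suc (2 * suc h) * k
          identity = solve-∀
  upper : ∀ k → k ≤ h → suc (2 * suc h) * k < suc k * P
  upper k k≤h = subst₂ _<_ (identity₁ k h) (identity₂ k h) (ℕₚ.+-monoˡ-< (k * P) (s≤s (ℕₚ.*-monoʳ-≤ 2 k≤h)))
    where identity₁ : ∀ k h → 2 * k + k * suc (2 * h) ≡ suc (2 * suc h) * k
          identity₁ = solve-∀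
          identity₂ : ∀ k h → suc (2 * h) + k * suc (2 * h) ≡ suc k * suc (2 * h)
          identity₂ = solve-∀

2-nonresidue : ∀ m → Prime (suc (2 * suc (4 * m))) → (+ 2) ℤ.^ suc (4 * m) ≡ ℤ.- + 1 [mod suc (2 * suc (4 * m)) ]
2-nonresidue m P-prime = mod-trans (second-supplement (suc (4 * m)) (s≤s z≤n) P-prime) (mod-reflexive (begin
  -1^ sumTo (λ k → k) (suc (4 * m))
    ≡⟨ cong -1^_ (ℕₚ.*-cancelʳ-≡ (sumTo (λ k → k) (suc (4 * m))) (suc (2 * (4 * m * m + 3 * m))) 2
                                (trans (gauss-sum (suc (4 * m))) (identity m))) ⟩
  -1^ suc (2 * (4 * m * m + 3 * m))     ≡⟨ cong ℤ.-_ (-1^-2* (4 * m * m + 3 * m)) ⟩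
  ℤ.- + 1                                ∎))
  where
  open ≡-Reasoning
  identity : ∀ m → suc (4 * m) * suc (suc (4 * m)) ≡ suc (2 * (4 * m * m + 3 * m)) * 2
  identity = solve-∀

2-residue : ∀ m → Prime (suc (2 * (3 + 4 * m))) → (+ 2) ℤ.^ (3 + 4 * m) ≡ + 1 [mod suc (2 * (3 + 4 * m)) ]
2-residue m P-prime = mod-trans (second-supplement (3 + 4 * m) (s≤s z≤n) P-prime) (mod-reflexive (begin
  -1^ sumTo (λ k → k) (3 + 4 * m)
    ≡⟨ cong -1^_ (ℕₚ.*-cancelʳ-≡ (sumTo (λ k → k) (3 + 4 * m)) (2 * ((3 + 4 * m) * (1 + m))) 2
                                (trans (gauss-sum (3 + 4 * m)) (identity m))) ⟩
  -1^ (2 * ((3 + 4 * m) * (1 + m)))     ≡⟨ -1^-2* ((3 + 4 * m) * (1 + m)) ⟩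
  + 1                                    ∎))
  where
  open ≡-Reasoning
  identity : ∀ m → (3 + 4 * m) * suc (3 + 4 * m) ≡ 2 * ((3 + 4 * m) * (1 + m)) * 2
  identity = solve-∀

quotient-of-P≡-1 : ∀ P b K j .{{_ : NonZero b}} → P + 1 ≡ b * (2 * K) → 1 ≤ j → j ≤ b → (P * j) / b + 1 ≡ 2 * K * j
quotient-of-P≡-1 P b K j P+1≡ 1≤j j≤b = trans (cong (_+ 1) (quotient-unique (P * j) b q lower upper)) (trans (ℕₚ.+-comm q 1) (sym 1+q≡))
  where
  1≤K : 1 ≤ K
  1≤K = ℕₚ.n≢0⇒n>0 (λ K≡0 → ℕₚ.0≢1+n (sym (trans (trans (ℕₚ.+-comm 1 P) P+1≡)
                                                 (trans (cong (λ z → b * (2 * z)) K≡0) (ℕₚ.*-zeroʳ b)))))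
  q : ℕ
  q = 2 * K * j ∸ 1
  1+q≡ : 2 * K * j ≡ suc q
  1+q≡ = sym (ℕₚ.m+[n∸m]≡n (ℕₚ.*-mono-≤ (ℕₚ.*-mono-≤ {1} {2} (s≤s z≤n) 1≤K) 1≤j))
  Pj+j≡ : P * j + j ≡ q * b + b
  Pj+j≡ = begin
    P * j + j          ≡⟨ identity₁ P j ⟩
    (P + 1) * j        ≡⟨ cong (_* j) P+1≡ ⟩
    b * (2 * K) * j    ≡⟨ identity₂ b K j ⟩
    2 * K * j * b      ≡⟨ cong (_* b) 1+q≡ ⟩
    suc q * b          ≡⟨ ℕₚ.+-comm b (q * b) ⟩
    q * b + b          ∎
    where open ≡-Reasoning
          identity₁ : ∀ P j → P * j + j ≡ (P + 1) * j
          identity₁ = solve-∀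
          identity₂ : ∀ b K j → b * (2 * K) * j ≡ 2 * K * j * b
          identity₂ = solve-∀
  lower : q * b ≤ P * j
  lower = ℕₚ.+-cancelʳ-≤ j (q * b) (P * j) (subst (q * b + j ≤_) (sym Pj+j≡) (ℕₚ.+-monoʳ-≤ (q * b) j≤b))
  upper : P * j < suc q * b
  upper = subst (P * j <_) (trans Pj+j≡ (ℕₚ.+-comm (q * b) b)) (ℕₚ.m<m+n (P * j) 1≤j)

T-of-P≡-1 : ∀ P β K → P + 1 ≡ suc (2 * β) * (2 * K) → -1^ T P β ≡ -1^ β
T-of-P≡-1 P β K P+1≡ = -1^-parity (T P β) β {c = 0} {d = K * sumTo (λ k → k) β} (trans (ℕₚ.+-identityʳ _) (begin
  T P β + β                          ≡⟨ cong (_+_ (T P β)) (trans (sym (ℕₚ.*-identityʳ β)) (sym (sumTo-const 1 β))) ⟩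
  T P β + sumTo (λ _ → 1) β          ≡⟨ sumTo-distrib-+ _ _ β ⟨
  sumTo (λ j → (P * j) / b + 1) β    ≡⟨ sumTo-cong β (λ j 1≤j j≤β → quotient-of-P≡-1 P b K j P+1≡ 1≤j (j≤b j≤β)) ⟩
  sumTo (λ j → 2 * K * j) β          ≡⟨ sumTo-*ˡ (2 * K) (λ k → k) β ⟩
  2 * K * sumTo (λ k → k) β          ≡⟨ ℕₚ.*-assoc 2 K _ ⟩
  2 * (K * sumTo (λ k → k) β)        ∎))
  where
  open ≡-Reasoning
  b : ℕ
  b = suc (2 * β)
  j≤b : ∀ {j} → j ≤ β → j ≤ b
  j≤b j≤β = ℕₚ.≤-trans j≤β (ℕₚ.≤-trans (ℕₚ.m≤m+n β (β + 0)) (ℕₚ.n≤1+n _))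

odd-residue : ∀ h′ β K → Prime (suc (2 * suc (2 * h′))) → ¬ suc (2 * suc (2 * h′)) ∣ suc (2 * β) →
              suc (2 * suc (2 * h′)) + 1 ≡ suc (2 * β) * (2 * K) →
              (+ suc (2 * β)) ℤ.^ suc (2 * h′) ≡ + 1 [mod suc (2 * suc (2 * h′)) ]
odd-residue h′ β K P-prime P∤b P+1≡ = mod-trans (gauss-lemma h b P-prime P∤b) (mod-reflexive (begin
  -1^ μ b h                          ≡⟨ μ-odd h β P-prime P∤b ⟩
  -1^ (h * β) ℤ.* -1^ T P β          ≡⟨ cong₂ ℤ._*_ (-1^-odd* h′ β) (T-of-P≡-1 P β K P+1≡) ⟩
  -1^ β ℤ.* -1^ β                    ≡⟨ -1^-square β ⟩
  + 1                                ∎))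
  where
  open ≡-Reasoning
  h : ℕ
  h = suc (2 * h′)
  P : ℕ
  P = suc (2 * h)
  b : ℕ
  b = suc (2 * β)

data Parity : ℕ → Set where
  even : ∀ k → Parity (2 * k)
  odd  : ∀ k → Parity (suc (2 * k))

parity : ∀ n → Parity n
parity zero = even 0
parity (suc n) with parity n
... | even k = odd k
... | odd k  = subst Parity (identity k) (even (suc k))
  where identity : ∀ k → 2 * suc k ≡ suc (suc (2 * k))
        identity = solve-∀

8∣P+1⇒h≡3[mod4] : ∀ h′ c → suc (2 * suc (2 * h′)) + 1 ≡ c * 8 → ∃ λ m → suc (2 * h′) ≡ 3 + 4 * m
8∣P+1⇒h≡3[mod4] h′ zero    P+1≡0 = ⊥-elim (ℕₚ.0≢1+n (sym (trans (ℕₚ.+-comm 1 (suc (2 * suc (2 * h′)))) P+1≡0)))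
8∣P+1⇒h≡3[mod4] h′ (suc m) P+1≡ =
  m , ℕₚ.*-cancelˡ-≡ (suc (2 * h′)) (3 + 4 * m) 2 (ℕₚ.+-cancelʳ-≡ 2 _ _ (trans (identity₁ h′) (trans P+1≡ (identity₂ m))))
  where identity₁ : ∀ h′ → 2 * suc (2 * h′) + 2 ≡ suc (2 * suc (2 * h′)) + 1
        identity₁ = solve-∀
        identity₂ : ∀ m → suc m * 8 ≡ 2 * (3 + 4 * m) + 2
        identity₂ = solve-∀

residue-of-divisor : ∀ h′ b → Prime (suc (2 * suc (2 * h′))) → 1 ≤ b → 8 * b ∣ suc (2 * suc (2 * h′)) + 1 →
                     ¬ suc (2 * suc (2 * h′)) ∣ b → (+ b) ℤ.^ suc (2 * h′) ≡ + 1 [mod suc (2 * suc (2 * h′)) ]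
residue-of-divisor h′ b P-prime = go b (<-wellFounded b)
  where
  h : ℕ
  h = suc (2 * h′)
  P : ℕ
  P = suc (2 * h)
  go : ∀ b → Acc _<_ b → 1 ≤ b → 8 * b ∣ P + 1 → ¬ P ∣ b → (+ b) ℤ.^ h ≡ + 1 [mod P ]
  go b (acc rec) 1≤b 8b∣P+1 P∤b with parity b | 8b∣P+1
  ... | odd β  | divides c P+1≡ = odd-residue h′ β (4 * c) P-prime P∤b (trans P+1≡ (identity c β))
    where identity : ∀ c β → c * (8 * suc (2 * β)) ≡ suc (2 * β) * (2 * (4 * c))
          identity = solve-∀
  ... | even b′ | _ = begin
    (+ (2 * b′)) ℤ.^ h                ≡⟨ cong (ℤ._^ h) (ℤₚ.pos-* 2 b′) ⟩
    (+ 2 ℤ.* + b′) ℤ.^ h              ≡⟨ ^-distrib-* (+ 2) (+ b′) h ⟩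
    (+ 2) ℤ.^ h ℤ.* (+ b′) ℤ.^ h      ≈⟨ mod-* 2^h≡1 b′^h≡1 ⟩
    + 1                               ∎
    where
    open ≡-mod-Reasoning P
    1≤b′ : 1 ≤ b′
    1≤b′ = ℕₚ.n≢0⇒n>0 (λ b′≡0 → ℕₚ.<⇒≱ 1≤b (ℕₚ.≤-reflexive (cong (2 *_) b′≡0)))
    b′<b : b′ < 2 * b′
    b′<b = subst (b′ <_) (cong (_+_ b′) (sym (ℕₚ.+-identityʳ b′))) (ℕₚ.m<m+n b′ 1≤b′)
    2^h≡1 : (+ 2) ℤ.^ h ≡ + 1 [mod P ]
    2^h≡1 with ∣-trans (m∣m*n (2 * b′)) 8b∣P+1
    ... | divides c P+1≡ with 8∣P+1⇒h≡3[mod4] h′ c P+1≡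
    ...   | m , h≡ = subst (λ z → (+ 2) ℤ.^ z ≡ + 1 [mod suc (2 * z) ]) (sym h≡) (2-residue m (subst (λ z → Prime (suc (2 * z))) h≡ P-prime))
    b′^h≡1 : (+ b′) ℤ.^ h ≡ + 1 [mod P ]
    b′^h≡1 = go b′ (rec b′<b) 1≤b′ (∣-trans (divides 2 (identity b′)) 8b∣P+1) (P∤b ∘ ∣n⇒∣m*n 2)
      where identity : ∀ b′ → 8 * (2 * b′) ≡ 2 * (8 * b′)
            identity = solve-∀

4-residue : ∀ l → 2 ≤ l → Prime (suc (2 * l)) → -1^ μ 4 l ≡ + 1
4-residue l 2≤l ℓ-prime = -1^-mod⇒≡ (μ 4 l) 0 ℓ>2 (begin
  -1^ μ 4 l                    ≈⟨ gauss-lemma l 4 ℓ-prime ℓ∤4 ⟨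
  (+ 4) ℤ.^ l                  ≡⟨ ^-distrib-* (+ 2) (+ 2) l ⟩
  (+ 2) ℤ.^ l ℤ.* (+ 2) ℤ.^ l  ≈⟨ fermat l 2 ℓ-prime ℓ∤2 ⟩
  + 1                          ∎)
  where
  open ≡-mod-Reasoning (suc (2 * l))
  ℓ≥5 : 5 ≤ suc (2 * l)
  ℓ≥5 = s≤s (ℕₚ.*-monoʳ-≤ 2 2≤l)
  ℓ>2 : 2 < suc (2 * l)
  ℓ>2 = ℕₚ.≤-trans (s≤s (s≤s (s≤s z≤n))) ℓ≥5
  ℓ∤4 : ¬ suc (2 * l) ∣ 4
  ℓ∤4 = prime∤-small (s≤s z≤n) ℓ≥5
  ℓ∤2 : ¬ suc (2 * l) ∣ 2
  ℓ∤2 = prime∤-small (s≤s z≤n) ℓ>2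

3-nonresidue : ∀ n → Prime (suc (2 * (2 + 12 * n))) → (+ 3) ℤ.^ (2 + 12 * n) ≡ ℤ.- + 1 [mod suc (2 * (2 + 12 * n)) ]
3-nonresidue n P-prime = mod-trans (gauss-lemma h 3 P-prime P∤3) (mod-reflexive (begin
  -1^ μ 3 h                   ≡⟨ μ-odd h 1 P-prime P∤3 ⟩
  -1^ (h * 1) ℤ.* -1^ T P 1   ≡⟨ cong₂ (λ x y → -1^ x ℤ.* -1^ y) (h*1≡ n) T≡ ⟩
  -1^ (2 * (1 + 6 * n)) ℤ.* -1^ suc (2 * (4 * n))  ≡⟨ cong₂ ℤ._*_ (-1^-2* (1 + 6 * n)) (cong ℤ.-_ (-1^-2* (4 * n))) ⟩
  ℤ.- + 1                     ∎))
  where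
  open ≡-Reasoning
  h : ℕ
  h = 2 + 12 * n
  P : ℕ
  P = suc (2 * h)
  P∤3 : ¬ P ∣ 3
  P∤3 = prime∤-small (s≤s z≤n) (subst (3 <_) (identity n) (ℕₚ.≤-trans (s≤s (s≤s (s≤s (s≤s z≤n)))) (ℕₚ.m≤m+n 5 (24 * n))))
    where identity : ∀ n → 5 + 24 * n ≡ suc (2 * (2 + 12 * n))
          identity = solve-∀
  h*1≡ : ∀ n → (2 + 12 * n) * 1 ≡ 2 * (1 + 6 * n)
  h*1≡ = solve-∀
  T≡ : T P 1 ≡ suc (2 * (4 * n))
  T≡ = trans (quotient-unique (P * 1) 3 (1 + 8 * n) lower upper) (identity₁ n)
    where
    identity₁ : ∀ n → 1 + 8 * n ≡ suc (2 * (4 * n))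
    identity₁ = solve-∀
    identity₂ : ∀ n → 3 + 24 * n ≡ (1 + 8 * n) * 3
    identity₂ = solve-∀
    identity₃ : ∀ n → 3 + 24 * n + 2 ≡ suc (2 * (2 + 12 * n)) * 1
    identity₃ = solve-∀
    identity₄ : ∀ n → suc (3 + 24 * n + 2) ≡ suc (1 + 8 * n) * 3
    identity₄ = solve-∀
    lower : (1 + 8 * n) * 3 ≤ P * 1
    lower = subst₂ _≤_ (identity₂ n) (identity₃ n) (ℕₚ.m≤m+n (3 + 24 * n) 2)
    upper : P * 1 < suc (1 + 8 * n) * 3
    upper = subst₂ _<_ (identity₃ n) (identity₄ n) (ℕₚ.n<1+n (3 + 24 * n + 2))

-- Power sums and quadratic non-residues

sum₀ : (ℕ → ℕ) → ℕ → ℕ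
sum₀ f zero    = f 0
sum₀ f (suc m) = sum₀ f m + f (suc m)

sum₀-shift : ∀ f m → sum₀ f (suc m) ≡ f 0 + sum₀ (f ∘ suc) m
sum₀-shift f zero    = refl
sum₀-shift f (suc m) = trans (cong (_+ f (suc (suc m))) (sum₀-shift f m)) (ℕₚ.+-assoc (f 0) _ _)

sum₀-distrib-+ : ∀ f g m → sum₀ (λ j → f j + g j) m ≡ sum₀ f m + sum₀ g m
sum₀-distrib-+ f g zero    = refl
sum₀-distrib-+ f g (suc m) = trans (cong (_+ (f (suc m) + g (suc m))) (sum₀-distrib-+ f g m))
                                   (identity (sum₀ f m) (sum₀ g m) (f (suc m)) (g (suc m)))
  where identity : ∀ a b c d → a + b + (c + d) ≡ a + c + (b + d)
        identity = solve-∀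

sum₀-*ˡ : ∀ c f m → sum₀ (λ j → c * f j) m ≡ c * sum₀ f m
sum₀-*ˡ c f zero    = refl
sum₀-*ˡ c f (suc m) = trans (cong (_+ c * f (suc m)) (sum₀-*ˡ c f m)) (sym (ℕₚ.*-distribˡ-+ c (sum₀ f m) (f (suc m))))

sum₀-cong : ∀ {f g} m → (∀ j → j ≤ m → f j ≡ g j) → sum₀ f m ≡ sum₀ g m
sum₀-cong zero    f≗g = f≗g 0 z≤n
sum₀-cong (suc m) f≗g = cong₂ _+_ (sum₀-cong m (λ j j≤m → f≗g j (ℕₚ.m≤n⇒m≤1+n j≤m))) (f≗g (suc m) ℕₚ.≤-refl)

sum₀-zero : ∀ m → sum₀ (λ _ → 0) m ≡ 0
sum₀-zero zero    = refl
sum₀-zero (suc m) = trans (ℕₚ.+-identityʳ _) (sum₀-zero m)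

sum₀-∣ : ∀ {d} f m → (∀ j → j ≤ m → d ∣ f j) → d ∣ sum₀ f m
sum₀-∣ f zero    d∣f = d∣f 0 z≤n
sum₀-∣ f (suc m) d∣f = ∣m∣n⇒∣m+n (sum₀-∣ f m (λ j j≤m → d∣f j (ℕₚ.m≤n⇒m≤1+n j≤m))) (d∣f (suc m) ℕₚ.≤-refl)

binomial-theorem : ∀ x m → sum₀ (λ j → (m C j) * x ^ j) m ≡ suc x ^ m
binomial-theorem x zero    = refl
binomial-theorem x (suc m) = begin
  sum₀ (λ j → (suc m C j) * x ^ j) (suc m)
    ≡⟨ sum₀-shift _ m ⟩
  1 * 1 + sum₀ (λ j → (suc m C suc j) * x ^ suc j) m
    ≡⟨ cong (_+_ 1) (sum₀-cong m (λ j _ → cong (_* x ^ suc j) (nCk+nC[k+1]≡[n+1]C[k+1] m j))) ⟨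
  1 + sum₀ (λ j → (m C j + m C suc j) * x ^ suc j) m
    ≡⟨ cong (_+_ 1) (sum₀-cong m (λ j _ → identity₁ (m C j) (m C suc j) x (x ^ j))) ⟩
  1 + sum₀ (λ j → x * ((m C j) * x ^ j) + (m C suc j) * x ^ suc j) m
    ≡⟨ cong (_+_ 1) (sum₀-distrib-+ _ _ m) ⟩
  1 + (sum₀ (λ j → x * ((m C j) * x ^ j)) m + sum₀ (λ j → (m C suc j) * x ^ suc j) m)
    ≡⟨ identity₂ 1 _ _ ⟩
  sum₀ (λ j → x * ((m C j) * x ^ j)) m + ((m C 0) * x ^ 0 + sum₀ (λ j → (m C suc j) * x ^ suc j) m)
    ≡⟨ cong₂ _+_ (sum₀-*ˡ x _ m) (sym (sum₀-shift (λ j → (m C j) * x ^ j) m)) ⟩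
  x * B + (B + (m C suc m) * x ^ suc m)
    ≡⟨ cong (λ z → x * B + (B + z * x ^ suc m)) (k>n⇒nCk≡0 {m} {suc m} (ℕₚ.n<1+n m)) ⟩
  x * B + (B + 0)
    ≡⟨ cong (λ z → x * z + (z + 0)) (binomial-theorem x m) ⟩
  x * suc x ^ m + (suc x ^ m + 0)
    ≡⟨ identity₃ x (suc x ^ m) ⟩
  suc x * suc x ^ m ∎
  where
  open ≡-Reasoning
  B : ℕ
  B = sum₀ (λ j → (m C j) * x ^ j) m
  identity₁ : ∀ a b x y → (a + b) * (x * y) ≡ x * (a * y) + b * (x * y)
  identity₁ = solve-∀
  identity₂ : ∀ u v w → u + (v + w) ≡ v + (u + w)
  identity₂ = solve-∀
  identity₃ : ∀ x y → x * y + (y + 0) ≡ suc x * y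
  identity₃ = solve-∀

powerSum : ℕ → ℕ → ℕ
powerSum k zero    = 0
powerSum k (suc n) = powerSum k n + n ^ k

powerSum-0 : ∀ n → powerSum 0 n ≡ n
powerSum-0 zero    = refl
powerSum-0 (suc n) = trans (cong (_+ 1) (powerSum-0 n)) (ℕₚ.+-comm n 1)

powerSum-binomial : ∀ m n → sum₀ (λ j → (suc m C j) * powerSum j n) m ≡ n ^ suc m
powerSum-binomial m zero    = trans (sum₀-cong m (λ j _ → ℕₚ.*-zeroʳ (suc m C j))) (sum₀-zero m)
powerSum-binomial m (suc n) = begin
  sum₀ (λ j → (suc m C j) * (powerSum j n + n ^ j)) m
    ≡⟨ sum₀-cong m (λ j _ → ℕₚ.*-distribˡ-+ (suc m C j) (powerSum j n) (n ^ j)) ⟩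
  sum₀ (λ j → (suc m C j) * powerSum j n + (suc m C j) * n ^ j) m
    ≡⟨ sum₀-distrib-+ _ _ m ⟩
  sum₀ (λ j → (suc m C j) * powerSum j n) m + sum₀ (λ j → (suc m C j) * n ^ j) m
    ≡⟨ cong (_+ sum₀ (λ j → (suc m C j) * n ^ j) m) (powerSum-binomial m n) ⟩
  n ^ suc m + sum₀ (λ j → (suc m C j) * n ^ j) m
    ≡⟨ ℕₚ.+-comm (n ^ suc m) _ ⟩
  sum₀ (λ j → (suc m C j) * n ^ j) m + n ^ suc m
    ≡⟨ cong (_+_ (sum₀ (λ j → (suc m C j) * n ^ j) m)) (trans (cong (_* n ^ suc m) (nCn≡1 (suc m))) (ℕₚ.*-identityˡ _)) ⟨
  sum₀ (λ j → (suc m C j) * n ^ j) (suc m)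
    ≡⟨ binomial-theorem n (suc m) ⟩
  suc n ^ suc m ∎
  where open ≡-Reasoning

-- By induction on k: in powerSum-binomial k ℓ every term except (k + 1) powerSum k ℓ is a multiple of ℓ.
powerSum-divisible : ∀ {ℓ} → Prime ℓ → ∀ k → 1 ≤ k → suc k < ℓ → ℓ ∣ powerSum k ℓ
powerSum-divisible {ℓ} ℓ-prime k = go k (<-wellFounded k)
  where
  go : ∀ k → Acc _<_ k → 1 ≤ k → suc k < ℓ → ℓ ∣ powerSum k ℓ
  go (suc k) (acc rec) _ 2+k<ℓ with euclidsLemma (suc (suc k)) (powerSum (suc k) ℓ) ℓ-prime ℓ∣top
    where
    f : ℕ → ℕ
    f = λ j → (suc (suc k) C j) * powerSum j ℓ
    ℓ∣lower : ℓ ∣ sum₀ f k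
    ℓ∣lower = sum₀-∣ f k ℓ∣term
      where
      ℓ∣term : ∀ j → j ≤ k → ℓ ∣ f j
      ℓ∣term zero    _   = subst (ℓ ∣_) (sym (trans (ℕₚ.*-identityˡ _) (powerSum-0 ℓ))) ∣-refl
      ℓ∣term (suc j) j<k = ∣n⇒∣m*n (suc (suc k) C suc j) (go (suc j) (rec (s≤s j<k)) (s≤s z≤n) (ℕₚ.<-trans (s≤s (s≤s j<k)) 2+k<ℓ))
    2+kC1+k≡ : (suc (suc k) C suc k) ≡ suc (suc k)
    2+kC1+k≡ = trans (nCk≡nC[n∸k] (ℕₚ.n≤1+n (suc k))) (trans (cong (suc (suc k) C_) (ℕₚ.m+n∸n≡m 1 (suc k))) (nC1≡n (suc (suc k))))
    ℓ∣top : ℓ ∣ suc (suc k) * powerSum (suc k) ℓ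
    ℓ∣top = subst (ℓ ∣_) (cong (_* powerSum (suc k) ℓ) 2+kC1+k≡)
              (∣m+n∣m⇒∣n (subst (ℓ ∣_) (sym (powerSum-binomial (suc k) ℓ)) (m∣m*n (ℓ ^ suc k))) ℓ∣lower)
  ... | inj₁ ℓ∣2+k = ⊥-elim (prime∤-small (s≤s z≤n) 2+k<ℓ ℓ∣2+k)
  ... | inj₂ ℓ∣S   = ℓ∣S

powerSum-mod : ∀ {m} h N → 1 ≤ h → (∀ c → 1 ≤ c → c ≤ N → (+ c) ℤ.^ h ≡ + 1 [mod m ]) → + powerSum h (suc N) ≡ + N [mod m ]
powerSum-mod (suc h) zero    _   _    = mod-refl
powerSum-mod {m} h (suc N) 1≤h c^h≡1 = begin
  + (powerSum h (suc N) + suc N ^ h)        ≡⟨ ℤₚ.pos-+ (powerSum h (suc N)) (suc N ^ h) ⟩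
  + powerSum h (suc N) ℤ.+ + (suc N ^ h)    ≡⟨ cong (ℤ._+_ (+ powerSum h (suc N))) (pos-^ (suc N) h) ⟨
  + powerSum h (suc N) ℤ.+ (+ suc N) ℤ.^ h  ≈⟨ mod-+ (powerSum-mod h N 1≤h (λ c 1≤c c≤N → c^h≡1 c 1≤c (ℕₚ.m≤n⇒m≤1+n c≤N)))
                                                    (c^h≡1 (suc N) (s≤s z≤n) ℕₚ.≤-refl) ⟩
  + N ℤ.+ + 1                               ≡⟨ ℤₚ.pos-+ N 1 ⟨
  + (N + 1)                                 ≡⟨ cong +_ (ℕₚ.+-comm N 1) ⟩
  + suc N                                   ∎
  where open ≡-mod-Reasoning m

-- If c^h ≡ 1 for all 0 < c < P, then powerSum h P ≡ P - 1, whereas P ∣ powerSum h P.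
∃-nonresidue : ∀ h → 1 ≤ h → Prime (suc (2 * h)) → ∃ λ c → 1 ≤ c × c ≤ 2 * h × -1^ μ c h ≡ ℤ.- + 1
∃-nonresidue h 1≤h P-prime with search (λ c → -1^ μ c h ℤ.≟ ℤ.- + 1) (2 * h)
... | inj₁ found = found
... | inj₂ none  = ⊥-elim (prime∤-small 1≤2h (ℕₚ.n<1+n (2 * h)) P∣2h)
  where
  P : ℕ
  P = suc (2 * h)
  1≤2h : 1 ≤ 2 * h
  1≤2h = ℕₚ.≤-trans 1≤h (ℕₚ.m≤m+n h (h + 0))
  c^h≡1 : ∀ c → 1 ≤ c → c ≤ 2 * h → (+ c) ℤ.^ h ≡ + 1 [mod P ]
  c^h≡1 c 1≤c c≤2h with -1^-cases (μ c h)
  ... | inj₂ μ-odd′ = ⊥-elim (none c 1≤c c≤2h μ-odd′)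
  ... | inj₁ μ-even = subst ((+ c) ℤ.^ h ≡_[mod P ]) μ-even (gauss-lemma h c P-prime (prime∤-small 1≤c (s≤s c≤2h)))
  P∣powerSum : P ∣ powerSum h P
  P∣powerSum = powerSum-divisible P-prime h 1≤h
    (s≤s (subst₂ _≤_ (ℕₚ.+-comm h 1) (cong (_+_ h) (sym (ℕₚ.+-identityʳ h))) (ℕₚ.+-monoʳ-≤ h 1≤h)))
  P∣2h : P ∣ 2 * h
  P∣2h = mod-∣ (powerSum-mod h (2 * h) 1≤h c^h≡1) P∣powerSum

-- Primitive roots modulo 2jq + 1

-1≢1[mod] : ∀ {p x} → 2 < p → x ≡ ℤ.- + 1 [mod p ] → ¬ x ≡ + 1 [mod p ]
-1≢1[mod] 2<p x≡-1 x≡1 = 1≢-1[mod] 2<p (mod-trans (mod-sym x≡1) x≡-1)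

^-*-≡1 : ∀ {p} g a n → g ℤ.^ a ≡ + 1 [mod p ] → g ℤ.^ (a * n) ≡ + 1 [mod p ]
^-*-≡1 g a n g^a≡1 = mod-trans (mod-reflexive (sym (ℤₚ.^-*-assoc g a n)))
                               (mod-trans (mod-^ n g^a≡1) (mod-reflexive (ℤₚ.^-zeroˡ n)))

^-+-≡1 : ∀ {p} g a b → g ℤ.^ (a + b) ≡ + 1 [mod p ] → g ℤ.^ b ≡ + 1 [mod p ] → g ℤ.^ a ≡ + 1 [mod p ]
^-+-≡1 {p} g a b g^a+b≡1 g^b≡1 = begin
  g ℤ.^ a                     ≡⟨ ℤₚ.*-identityʳ (g ℤ.^ a) ⟨
  g ℤ.^ a ℤ.* + 1             ≈⟨ mod-* (mod-refl {x = g ℤ.^ a}) g^b≡1 ⟨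
  g ℤ.^ a ℤ.* g ℤ.^ b         ≡⟨ ℤₚ.^-distribˡ-+-* g a b ⟨
  g ℤ.^ (a + b)               ≈⟨ g^a+b≡1 ⟩
  + 1                         ∎
  where open ≡-mod-Reasoning p

^-≡0 : ∀ {p x} n → 1 ≤ n → x ≡ + 0 [mod p ] → x ℤ.^ n ≡ + 0 [mod p ]
^-≡0 {x = x} (suc n) _ x≡0 = mod-trans (mod-* x≡0 mod-refl) (mod-reflexive (ℤₚ.*-zeroˡ (x ℤ.^ n)))

prime∤⇒coprime : ∀ {q k} → Prime q → ¬ q ∣ k → Coprime k q
prime∤⇒coprime q-prime q∤k (d∣k , d∣q) with prime⇒irreducible q-prime d∣q
... | inj₁ d≡1 = d≡1
... | inj₂ refl = ⊥-elim (q∤k d∣k)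

1∨2⇒1≤ : ∀ {j} → j ≡ 1 ⊎ j ≡ 2 → 1 ≤ j
1∨2⇒1≤ (inj₁ refl) = s≤s z≤n
1∨2⇒1≤ (inj₂ refl) = s≤s z≤n

multiple-exponent : ∀ {p} g q j i → j ≡ 1 ⊎ j ≡ 2 → 2 < p → 1 ≤ i → i < 2 * j →
                    g ℤ.^ (j * q) ≡ ℤ.- + 1 [mod p ] → g ℤ.^ (2 * j * q) ≡ + 1 [mod p ] → ¬ g ℤ.^ (i * q) ≡ + 1 [mod p ]
multiple-exponent g q .1 1 (inj₁ refl) 2<p _ _ g^q≡-1 _ = -1≢1[mod] 2<p g^q≡-1
multiple-exponent g q .1 (suc (suc i)) (inj₁ refl) _ _ (s≤s (s≤s ())) _ _
multiple-exponent {p} g q .2 1 (inj₂ refl) 2<p _ _ g^2q≡-1 _ g^q≡1 =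
  -1≢1[mod] 2<p g^2q≡-1 (subst (λ n → g ℤ.^ n ≡ + 1 [mod p ]) (identity q) (^-*-≡1 g (1 * q) 2 g^q≡1))
  where identity : ∀ q → 1 * q * 2 ≡ 2 * q
        identity = solve-∀
multiple-exponent g q .2 2 (inj₂ refl) 2<p _ _ g^2q≡-1 _ = -1≢1[mod] 2<p g^2q≡-1
multiple-exponent {p} g q .2 3 (inj₂ refl) 2<p _ _ g^2q≡-1 g^4q≡1 g^3q≡1 =
  multiple-exponent g q 2 1 (inj₂ refl) 2<p (s≤s z≤n) (s≤s (s≤s z≤n)) g^2q≡-1 g^4q≡1
    (^-+-≡1 g (1 * q) (3 * q) (subst (λ n → g ℤ.^ n ≡ + 1 [mod p ]) (identity q) g^4q≡1) g^3q≡1)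
  where identity : ∀ q → 2 * 2 * q ≡ 1 * q + 3 * q
        identity = solve-∀
multiple-exponent g q .2 (suc (suc (suc (suc i)))) (inj₂ refl) _ _ (s≤s (s≤s (s≤s (s≤s ())))) _ _

module PrimitiveRootCriterion (g : ℤ) (p q j : ℕ) (q-prime : Prime q) (2<p : 2 < p)
  (p≡ : p ≡ suc (2 * j * q)) (j≡1∨2 : j ≡ 1 ⊎ j ≡ 2)
  (g^jq≡-1 : g ℤ.^ (j * q) ≡ ℤ.- + 1 [mod p ]) (g^2j≢1 : ¬ g ℤ.^ (2 * j) ≡ + 1 [mod p ]) where

  open ≡-mod-Reasoning p

  g^2jq≡1 : g ℤ.^ (2 * j * q) ≡ + 1 [mod p ]
  g^2jq≡1 = begin
    g ℤ.^ (2 * j * q)         ≡⟨ cong (g ℤ.^_) (identity j q) ⟩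
    g ℤ.^ (j * q * 2)         ≡⟨ ℤₚ.^-*-assoc g (j * q) 2 ⟨
    (g ℤ.^ (j * q)) ℤ.^ 2     ≈⟨ mod-^ 2 g^jq≡-1 ⟩
    + 1                       ∎
    where identity : ∀ j q → 2 * j * q ≡ j * q * 2
          identity = solve-∀

  p∤g : ¬ + p ℤ÷.∣ g
  p∤g p∣g = ℕₚ.<⇒≱ (ℕₚ.<-trans (ℕₚ.n<1+n 1) 2<p) (∣⇒≤ (ℤ÷.∣⇒∣ᵤ (mod-0⇒∣ (begin
    ℤ.- + 1          ≈⟨ g^jq≡-1 ⟨
    g ℤ.^ (j * q)    ≈⟨ ^-≡0 (j * q) 1≤jq (∣⇒mod-0 p∣g) ⟩
    + 0              ∎))))
    where
    1≤jq : 1 ≤ j * q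
    1≤jq = ℕₚ.*-mono-≤ (1∨2⇒1≤ j≡1∨2) (ℕₚ.<⇒≤ (prime⇒2≤ q-prime))

  private
    g^2j≡1-from-gap : ∀ M N → 1 + M ≡ N → g ℤ.^ (2 * j * N) ≡ + 1 [mod p ] → g ℤ.^ (2 * j * M) ≡ + 1 [mod p ] →
                      g ℤ.^ (2 * j) ≡ + 1 [mod p ]
    g^2j≡1-from-gap M N 1+M≡N g^2jN≡1 g^2jM≡1 = ^-+-≡1 g (2 * j) (2 * j * M)
      (subst (λ n → g ℤ.^ n ≡ + 1 [mod p ]) (trans (cong (2 * j *_) (sym 1+M≡N)) (ℕₚ.*-suc (2 * j) M)) g^2jN≡1) g^2jM≡1

    g^2jqy≡1 : ∀ y → g ℤ.^ (2 * j * (y * q)) ≡ + 1 [mod p ]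
    g^2jqy≡1 y = subst (λ n → g ℤ.^ n ≡ + 1 [mod p ]) (identity j q y) (^-*-≡1 g (2 * j * q) y g^2jq≡1)
      where identity : ∀ j q y → 2 * j * q * y ≡ 2 * j * (y * q)
            identity = solve-∀

    g^2jkx≡1 : ∀ {k} x → g ℤ.^ k ≡ + 1 [mod p ] → g ℤ.^ (2 * j * (x * k)) ≡ + 1 [mod p ]
    g^2jkx≡1 {k} x g^k≡1 = subst (λ n → g ℤ.^ n ≡ + 1 [mod p ]) (identity j x k) (^-*-≡1 g k (2 * j * x) g^k≡1)
      where identity : ∀ j x k → k * (2 * j * x) ≡ 2 * j * (x * k)
            identity = solve-∀

  coprime-exponent : ∀ k → ¬ q ∣ k → ¬ g ℤ.^ k ≡ + 1 [mod p ]
  coprime-exponent k q∤k g^k≡1 = g^2j≢1 (from-Bézout (coprime-Bézout (prime∤⇒coprime q-prime q∤k)))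
    where
    from-Bézout : Bézout.Identity 1 k q → g ℤ.^ (2 * j) ≡ + 1 [mod p ]
    from-Bézout (Bézout.+- x y 1+yq≡xk) = g^2j≡1-from-gap (y * q) (x * k) 1+yq≡xk (g^2jkx≡1 x g^k≡1) (g^2jqy≡1 y)
    from-Bézout (Bézout.-+ x y 1+xk≡yq) = g^2j≡1-from-gap (x * k) (y * q) 1+xk≡yq (g^2jqy≡1 y) (g^2jkx≡1 x g^k≡1)

  order≮ : ∀ k → 1 ≤ k → k < p ∸ 1 → ¬ g ℤ.^ k ≡ + 1 [mod p ]
  order≮ k 1≤k k<p-1 = by-divisibility (q ∣? k)
    where
    by-divisibility : Dec (q ∣ k) → ¬ g ℤ.^ k ≡ + 1 [mod p ]
    by-divisibility (no q∤k) = coprime-exponent k q∤k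
    by-divisibility (yes (divides i k≡iq)) g^k≡1 =
      multiple-exponent g q j i j≡1∨2 2<p 1≤i i<2j g^jq≡-1 g^2jq≡1 (subst (λ n → g ℤ.^ n ≡ + 1 [mod p ]) k≡iq g^k≡1)
      where
      1≤i : 1 ≤ i
      1≤i = ℕₚ.n≢0⇒n>0 (λ i≡0 → ℕₚ.<⇒≱ 1≤k (ℕₚ.≤-reflexive (trans k≡iq (cong (_* q) i≡0))))
      i<2j : i < 2 * j
      i<2j = ℕₚ.*-cancelʳ-< q i (2 * j) (subst₂ _<_ k≡iq (cong (_∸ 1) p≡) k<p-1)

  isPrimitiveRoot : IsPrimitiveRoot g p
  isPrimitiveRoot = p∤g ∘ ℤ÷.∣ᵤ⇒∣ , λ k 1≤k k<p-1 p∣g^k-1 → order≮ k 1≤k k<p-1 (mod (ℤ÷.∣ᵤ⇒∣ p∣g^k-1))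

∣^∣ : ∀ g s → ∣ g ℤ.^ s ∣ ≡ ∣ g ∣ ^ s
∣^∣ g zero    = refl
∣^∣ g (suc s) = trans (ℤₚ.abs-* g (g ℤ.^ s)) (cong (∣ g ∣ *_) (∣^∣ g s))

small-power≢1 : ∀ {p} g s → 2 ≤ ∣ g ∣ → 1 ≤ s → s ≤ 4 → ∣ g ∣ ^ 4 + 1 < p → ¬ g ℤ.^ s ≡ + 1 [mod p ]
small-power≢1 {p} g s 2≤∣g∣ 1≤s s≤4 big (mod p∣g^s-1) with ∣ g ℤ.^ s ℤ.- + 1 ∣ ≟ 0
... | yes ∣g^s-1∣≡0 = ℕₚ.<⇒≢ (ℕₚ.<-≤-trans (ℕₚ.n<1+n 1) 2≤∣g^s∣) (sym ∣g^s∣≡1)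
  where
  g^s≡1 : g ℤ.^ s ≡ + 1
  g^s≡1 = trans (identity (g ℤ.^ s)) (cong (ℤ._+ + 1) (ℤₚ.∣i∣≡0⇒i≡0 {g ℤ.^ s ℤ.- + 1} ∣g^s-1∣≡0))
    where identity : ∀ x → x ≡ (x ℤ.- + 1) ℤ.+ + 1
          identity = ℤRing.solve-∀
  ∣g^s∣≡1 : ∣ g ∣ ^ s ≡ 1
  ∣g^s∣≡1 = trans (sym (∣^∣ g s)) (cong ∣_∣ g^s≡1)
  2≤∣g^s∣ : 2 ≤ ∣ g ∣ ^ s
  2≤∣g^s∣ = ℕₚ.≤-trans 2≤∣g∣ (ℕₚ.≤-trans (ℕₚ.≤-reflexive (sym (ℕₚ.*-identityʳ ∣ g ∣)))
                                         (ℕₚ.^-monoʳ-≤ ∣ g ∣ {{ℕ.>-nonZero (ℕₚ.<-trans (s≤s z≤n) 2≤∣g∣)}} 1≤s))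
... | no ∣g^s-1∣≢0 = ℕₚ.<⇒≱ big (begin
  p                          ≤⟨ ∣⇒≤ {{ℕ.≢-nonZero ∣g^s-1∣≢0}} (ℤ÷.∣⇒∣ᵤ p∣g^s-1) ⟩
  ∣ g ℤ.^ s ℤ.- + 1 ∣        ≤⟨ ℤₚ.∣i-j∣≤∣i∣+∣j∣ (g ℤ.^ s) (+ 1) ⟩
  ∣ g ℤ.^ s ∣ + 1            ≡⟨ cong (_+ 1) (∣^∣ g s) ⟩
  ∣ g ∣ ^ s + 1              ≤⟨ ℕₚ.+-monoˡ-≤ 1 (ℕₚ.^-monoʳ-≤ ∣ g ∣ {{ℕ.>-nonZero (ℕₚ.<-trans (s≤s z≤n) 2≤∣g∣)}} s≤4) ⟩
  ∣ g ∣ ^ 4 + 1              ∎)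
  where open ℕₚ.≤-Reasoning

-- Admissible pairs of linear forms

module Admissible (A B s r : ℕ) (r-prime : Prime r) (r∤sA : ¬ r ∣ s * A) (r∤2 : ¬ r ∣ 2) where

  c : ℕ → ℕ
  c k = A * k + B

  r∤1∨2 : ∀ d → d ≡ 1 ⊎ d ≡ 2 → ¬ r ∣ d
  r∤1∨2 .1 (inj₁ refl) = prime∤1 r-prime
  r∤1∨2 .2 (inj₂ refl) = r∤2

  -- Modulo r, each of the two forms vanishes at most once among three consecutive arguments.
  first-once : ∀ n d → d ≡ 1 ⊎ d ≡ 2 → r ∣ c n → ¬ r ∣ c (n + d)
  first-once n d d≡1∨2 r∣cn r∣cn+d =
    [ r∤sA ∘ ∣n⇒∣m*n s , r∤1∨2 d d≡1∨2 ]′ (euclidsLemma A d r-prime (∣m+n∣m⇒∣n (subst (r ∣_) (identity A n d B) r∣cn+d) r∣cn))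
    where identity : ∀ A n d B → A * (n + d) + B ≡ A * n + B + A * d
          identity = solve-∀

  second-once : ∀ n d → d ≡ 1 ⊎ d ≡ 2 → r ∣ s * c n + 1 → ¬ r ∣ s * c (n + d) + 1
  second-once n d d≡1∨2 r∣ r∣′ =
    [ r∤sA , r∤1∨2 d d≡1∨2 ]′ (euclidsLemma (s * A) d r-prime (∣m+n∣m⇒∣n (subst (r ∣_) (identity s A n d B) r∣′) r∣))
    where identity : ∀ s A n d B → s * (A * (n + d) + B) + 1 ≡ s * (A * n + B) + 1 + s * A * d
          identity = solve-∀

  Vanishes : ℕ → Set
  Vanishes k = r ∣ c k * (s * c k + 1)

  not-all-three : Vanishes 0 → Vanishes 1 → Vanishes 2 → ⊥
  not-all-three v₀ v₁ v₂ = cases (split 0 v₀) (split 1 v₁) (split 2 v₂)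
    where
    Split : ℕ → Set
    Split k = (r ∣ c k) ⊎ (r ∣ s * c k + 1)
    split : ∀ k → Vanishes k → Split k
    split k = euclidsLemma (c k) (s * c k + 1) r-prime
    cases : Split 0 → Split 1 → Split 2 → ⊥
    cases (inj₁ x) (inj₁ y) _        = first-once 0 1 (inj₁ refl) x y
    cases (inj₂ x) (inj₂ y) _        = second-once 0 1 (inj₁ refl) x y
    cases (inj₁ x) (inj₂ _) (inj₁ z) = first-once 0 2 (inj₂ refl) x z
    cases (inj₁ _) (inj₂ y) (inj₂ z) = second-once 1 1 (inj₁ refl) y z
    cases (inj₂ x) (inj₁ _) (inj₂ z) = second-once 0 2 (inj₂ refl) x z
    cases (inj₂ _) (inj₁ y) (inj₁ z) = first-once 1 1 (inj₁ refl) y z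

  nonvanishing : ∃ λ k → ¬ Vanishes k
  nonvanishing with r ∣? c 0 * (s * c 0 + 1) | r ∣? c 1 * (s * c 1 + 1) | r ∣? c 2 * (s * c 2 + 1)
  ... | no ¬v₀ | _      | _      = 0 , ¬v₀
  ... | yes _  | no ¬v₁ | _      = 1 , ¬v₁
  ... | yes _  | yes _  | no ¬v₂ = 2 , ¬v₂
  ... | yes v₀ | yes v₁ | yes v₂ = ⊥-elim (not-all-three v₀ v₁ v₂)

admissible : ∀ A B s → 2 ∣ s → (∀ r → Prime r → r ∣ s * A → ¬ r ∣ B * (s * B + 1)) →
             ∀ r → Prime r → ∃ λ k → ¬ r ∣ (A * k + B) * (s * (A * k + B) + 1)
admissible A B s 2∣s at-divisors r r-prime with r ∣? s * A
... | yes r∣sA = 0 , subst (λ z → ¬ r ∣ z * (s * z + 1)) (sym (cong (_+ B) (ℕₚ.*-zeroʳ A))) (at-divisors r r-prime r∣sA)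
... | no r∤sA  = Admissible.nonvanishing A B s r r-prime r∤sA (λ r∣2 → r∤sA (∣-trans r∣2 (∣-trans 2∣s (m∣m*n A))))

record NonResidueProgression (g : ℤ) : Set where
  field
    j A B         : ℕ
    j≡1∨2         : j ≡ 1 ⊎ j ≡ 2
    1≤A           : 1 ≤ A
    admissible-at : ∀ r → Prime r → r ∣ 2 * j * A → ¬ r ∣ B * (2 * j * B + 1)
    nonresidue    : ∀ m → Prime (A * m + B) → Prime (suc (2 * j * (A * m + B))) → ∣ g ∣ < suc (2 * j * (A * m + B)) →
                    g ℤ.^ (j * (A * m + B)) ≡ ℤ.- + 1 [mod suc (2 * j * (A * m + B)) ]

module _ (tc : TC2) {g : ℤ} (2≤∣g∣ : 2 ≤ ∣ g ∣) (progression : NonResidueProgression g) where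
  open NonResidueProgression progression

  private
    s : ℕ
    s = 2 * j
    G : ℕ
    G = ∣ g ∣
    G⁴ : ℕ
    G⁴ = ∣ g ∣ ^ 4

    -- Once p exceeds it, p > N, p ∤ g and g ^ (2 j) ≢ 1 (mod p); it also excludes negative solutions of TC(2).
    bound : ℕ → ℕ
    bound N = N + B + G + G⁴ + 3

    B<bound : ∀ N → B < bound N
    B<bound N = subst (B <_) (sym (identity N B G G⁴)) (ℕₚ.m<m+n B (s≤s z≤n))
      where identity : ∀ N B G G⁴ → N + B + G + G⁴ + 3 ≡ B + suc (N + G + G⁴ + 2)
            identity = solve-∀
    N≤bound : ∀ N → N ≤ bound N
    N≤bound N = subst (N ≤_) (sym (identity N B G G⁴)) (ℕₚ.m≤m+n N _)
      where identity : ∀ N B G G⁴ → N + B + G + G⁴ + 3 ≡ N + (B + G + G⁴ + 3)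
            identity = solve-∀
    G<bound : ∀ N → G < bound N
    G<bound N = subst (G <_) (sym (identity N B G G⁴)) (ℕₚ.m<m+n G (s≤s z≤n))
      where identity : ∀ N B G G⁴ → N + B + G + G⁴ + 3 ≡ G + suc (N + B + G⁴ + 2)
            identity = solve-∀
    G⁴+1<bound : ∀ N → G⁴ + 1 < bound N
    G⁴+1<bound N = subst (G⁴ + 1 <_) (sym (identity N B G G⁴)) (ℕₚ.m<m+n (G⁴ + 1) (s≤s z≤n))
      where identity : ∀ N B G G⁴ → N + B + G + G⁴ + 3 ≡ G⁴ + 1 + suc (N + B + G + 1)
            identity = solve-∀
    2<bound : ∀ N → 2 < bound N
    2<bound N = subst (2 <_) (sym (identity N B G G⁴)) (ℕₚ.m<m+n 2 (s≤s z≤n))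
      where identity : ∀ N B G G⁴ → N + B + G + G⁴ + 3 ≡ 2 + suc (N + B + G + G⁴)
            identity = solve-∀

    form : ∀ a b k → + a ℤ.* + k ℤ.+ + b ≡ + (a * k + b)
    form a b k = cong (ℤ._+ + b) (sym (ℤₚ.pos-* a k))

    admissible-pair : ∀ r → Prime r → ∃ λ n → ¬ + r ∣ᵤ (+ A ℤ.* n ℤ.+ + B) ℤ.* (+ (s * A) ℤ.* n ℤ.+ + (s * B + 1))
    admissible-pair r r-prime with admissible A B s (divides j (ℕₚ.*-comm 2 j)) admissible-at r r-prime
    ... | k , r∤ = + k , λ r∣ → r∤ (subst (r ∣_) ∣value∣ r∣)
      where
      identity : ∀ s A k B → s * A * k + (s * B + 1) ≡ s * (A * k + B) + 1
      identity = solve-∀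
      ∣value∣ : ∣ (+ A ℤ.* + k ℤ.+ + B) ℤ.* (+ (s * A) ℤ.* + k ℤ.+ + (s * B + 1)) ∣ ≡ (A * k + B) * (s * (A * k + B) + 1)
      ∣value∣ = trans (cong ∣_∣ (trans (cong₂ ℤ._*_ (form A B k) (form (s * A) (s * B + 1) k)) (sym (ℤₚ.pos-* (A * k + B) _))))
                      (cong (λ z → (A * k + B) * z) (identity s A k B))

    negative-impossible : ∀ N k q → bound N ≤ suc k → + A ℤ.* -[1+ k ] ℤ.+ + B ≢ + q
    negative-impossible N k q bound≤ value≡q = ℕₚ.<⇒≱ (ℕₚ.<-≤-trans (B<bound N) bound≤) (begin
      suc k            ≤⟨ ℕₚ.m≤n*m (suc k) A {{ℕ.>-nonZero 1≤A}} ⟩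
      A * suc k        ≤⟨ ℕₚ.m≤n+m (A * suc k) q ⟩
      q + A * suc k    ≡⟨ B≡ ⟨
      B                ∎)
      where
      open ℕₚ.≤-Reasoning
      identity : ∀ a b x → b ≡ (a ℤ.* ℤ.- x ℤ.+ b) ℤ.+ a ℤ.* x
      identity = ℤRing.solve-∀
      B≡ : B ≡ q + A * suc k
      B≡ = ℤₚ.+-injective (trans (identity (+ A) (+ B) (+ suc k))
                                 (trans (cong (ℤ._+ (+ A ℤ.* + suc k)) value≡q) (cong (ℤ._+_ (+ q)) (sym (ℤₚ.pos-* A (suc k))))))

  primitive-roots : InfinitelyManyℕ (λ p → Prime p × IsPrimitiveRoot g p)
  primitive-roots N with tc (+ A) (+ (s * A)) (+ B) (+ (s * B + 1)) (ℤ.+<+ 1≤A) (ℤ.+<+ 1≤sA) admissible-pair (bound N)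
    where 1≤sA : 1 ≤ s * A
          1≤sA = ℕₚ.*-mono-≤ (ℕₚ.*-mono-≤ {1} {2} (s≤s z≤n) (1∨2⇒1≤ j≡1∨2)) 1≤A
  ... | -[1+ k ] , bound≤ , (q , value≡q , _) , _ = ⊥-elim (negative-impossible N k q bound≤ value≡q)
  ... | + m , bound≤m , (q , q≡ , q-prime) , (p , p≡ , p-prime) =
    P , ℕₚ.≤-trans (N≤bound N) bound≤P , P-prime ,
    PrimitiveRootCriterion.isPrimitiveRoot g P Q j Q-prime (ℕₚ.<-≤-trans (2<bound N) bound≤P) refl j≡1∨2
      (nonresidue m Q-prime P-prime (ℕₚ.<-≤-trans (G<bound N) bound≤P))
      (small-power≢1 g s 2≤∣g∣ (ℕₚ.*-mono-≤ {1} {2} (s≤s z≤n) (1∨2⇒1≤ j≡1∨2)) (s≤4 j≡1∨2)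
                     (ℕₚ.<-≤-trans (G⁴+1<bound N) bound≤P))
    where
    Q : ℕ
    Q = A * m + B
    P : ℕ
    P = suc (2 * j * Q)
    Q-prime : Prime Q
    Q-prime = subst Prime (ℤₚ.+-injective (trans (sym q≡) (form A B m))) q-prime
    P-prime : Prime P
    P-prime = subst Prime (trans (ℤₚ.+-injective (trans (sym p≡) (form (s * A) (s * B + 1) m))) (identity j A m B)) p-prime
      where identity : ∀ j A m B → 2 * j * A * m + (2 * j * B + 1) ≡ suc (2 * j * (A * m + B))
            identity = solve-∀
    s≤4 : j ≡ 1 ⊎ j ≡ 2 → 2 * j ≤ 4
    s≤4 (inj₁ refl) = s≤s (s≤s z≤n)
    s≤4 (inj₂ refl) = ℕₚ.≤-refl
    bound≤P : bound N ≤ P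
    bound≤P = begin
      bound N      ≤⟨ bound≤m ⟩
      m            ≤⟨ ℕₚ.m≤n*m m A {{ℕ.>-nonZero 1≤A}} ⟩
      A * m        ≤⟨ ℕₚ.m≤m+n (A * m) B ⟩
      Q            ≤⟨ ℕₚ.m≤n*m Q (2 * j) {{ℕ.>-nonZero (ℕₚ.*-mono-≤ {1} {2} (s≤s z≤n) (1∨2⇒1≤ j≡1∨2))}} ⟩
      2 * j * Q    ≤⟨ ℕₚ.n≤1+n _ ⟩
      P            ∎
      where open ℕₚ.≤-Reasoning

-1^-odd-power : ∀ e h′ → (-1^ e) ℤ.^ suc (2 * h′) ≡ -1^ e
-1^-odd-power e h′ = trans (-1^-^ e (suc (2 * h′))) (trans (cong -1^_ (ℕₚ.*-comm e _)) (-1^-odd* h′ e))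

square-power : ∀ h t → Prime (suc (2 * h)) → ¬ suc (2 * h) ∣ t → (+ (t * t)) ℤ.^ h ≡ + 1 [mod suc (2 * h) ]
square-power h t P-prime P∤t = begin
  (+ (t * t)) ℤ.^ h            ≡⟨ cong (ℤ._^ h) (ℤₚ.pos-* t t) ⟩
  (+ t ℤ.* + t) ℤ.^ h          ≡⟨ ^-distrib-* (+ t) (+ t) h ⟩
  (+ t) ℤ.^ h ℤ.* (+ t) ℤ.^ h  ≈⟨ fermat h t P-prime P∤t ⟩
  + 1                          ∎
  where open ≡-mod-Reasoning (suc (2 * h))

∤-large : ∀ {P x a} → x ∣ a → 1 ≤ a → a < P → ¬ P ∣ x
∤-large x∣a 1≤a a<P P∣x = prime∤-small 1≤a a<P (∣-trans P∣x x∣a)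

nonresidue-at : ∀ {g q} q′ → q ≡ q′ → g ℤ.^ q′ ≡ ℤ.- + 1 [mod suc (2 * q′) ] →
                g ℤ.^ (1 * q) ≡ ℤ.- + 1 [mod suc (2 * 1 * q) ]
nonresidue-at {g} {q} _ refl g^q≡-1 = subst (λ n → g ℤ.^ n ≡ ℤ.- + 1 [mod suc (2 * q) ]) (sym (ℕₚ.*-identityˡ q)) g^q≡-1

-square-progression : ∀ t → 2 ≤ t → NonResidueProgression (ℤ.- + (t * t))
-square-progression t 2≤t = record
  { j = 1 ; A = 2 ; B = 1 ; j≡1∨2 = inj₁ refl ; 1≤A = s≤s z≤n
  ; admissible-at = λ r r-prime r∣4 r∣3 → prime∤1 r-prime (∣m+n∣m⇒∣n r∣4 r∣3)
  ; nonresidue = λ m _ P-prime g<P → nonresidue-at (suc (2 * m)) (ℕₚ.+-comm (2 * m) 1)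
      (nonresidue m (subst (λ z → Prime (suc (2 * z))) (ℕₚ.+-comm (2 * m) 1) P-prime)
                    (subst₂ (λ x z → x < suc (2 * z)) (ℤₚ.∣-i∣≡∣i∣ (+ (t * t))) (ℕₚ.+-comm (2 * m) 1) g<P))
  }
  where
  nonresidue : ∀ m → Prime (suc (2 * suc (2 * m))) → t * t < suc (2 * suc (2 * m)) →
               (ℤ.- + (t * t)) ℤ.^ suc (2 * m) ≡ ℤ.- + 1 [mod suc (2 * suc (2 * m)) ]
  nonresidue m P-prime t²<P = begin
    (ℤ.- + (t * t)) ℤ.^ q                       ≡⟨ cong (ℤ._^ q) (ℤₚ.-1*i≡-i (+ (t * t))) ⟨
    (-1^ 1 ℤ.* + (t * t)) ℤ.^ q                 ≡⟨ ^-distrib-* (-1^ 1) (+ (t * t)) q ⟩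
    (-1^ 1) ℤ.^ q ℤ.* (+ (t * t)) ℤ.^ q         ≈⟨ mod-* (mod-reflexive (-1^-odd-power 1 m)) (square-power q t P-prime P∤t) ⟩
    ℤ.- + 1 ℤ.* + 1                             ≡⟨ ℤₚ.*-identityʳ (ℤ.- + 1) ⟩
    ℤ.- + 1                                     ∎
    where
    open ≡-mod-Reasoning (suc (2 * suc (2 * m)))
    q : ℕ
    q = suc (2 * m)
    P∤t : ¬ suc (2 * suc (2 * m)) ∣ t
    P∤t = ∤-large (divides t refl) (ℕₚ.*-mono-≤ (ℕₚ.<⇒≤ 2≤t) (ℕₚ.<⇒≤ 2≤t)) t²<P

3·square-progression : ∀ u → 1 ≤ u → NonResidueProgression (+ (u * u * 3))
3·square-progression u 1≤u = record
  { j = 2 ; A = 6 ; B = 1 ; j≡1∨2 = inj₂ refl ; 1≤A = s≤s z≤n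
  ; admissible-at = λ r r-prime r∣24 r∣5 → prime∤1 r-prime (∣m+n∣m⇒∣n {m = 4} r∣5 (∣m+n∣m⇒∣n {m = 20} r∣24 (∣n⇒∣m*n 4 r∣5)))
  ; nonresidue = λ m _ P-prime g<P → subst₂ (λ x y → (+ (u * u * 3)) ℤ.^ x ≡ ℤ.- + 1 [mod suc y ]) (sym (h≡ m)) (sym (2h≡ m))
      (nonresidue m (subst (λ z → Prime (suc z)) (2h≡ m) P-prime) (subst (λ z → u * u * 3 < suc z) (2h≡ m) g<P))
  }
  where
  h≡ : ∀ m → 2 * (6 * m + 1) ≡ 2 + 12 * m
  h≡ = solve-∀
  2h≡ : ∀ m → 2 * 2 * (6 * m + 1) ≡ 2 * (2 + 12 * m)
  2h≡ = solve-∀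
  nonresidue : ∀ m → Prime (suc (2 * (2 + 12 * m))) → u * u * 3 < suc (2 * (2 + 12 * m)) →
               (+ (u * u * 3)) ℤ.^ (2 + 12 * m) ≡ ℤ.- + 1 [mod suc (2 * (2 + 12 * m)) ]
  nonresidue m P-prime g<P = begin
    (+ (u * u * 3)) ℤ.^ h                 ≡⟨ cong (ℤ._^ h) (ℤₚ.pos-* (u * u) 3) ⟩
    (+ (u * u) ℤ.* + 3) ℤ.^ h             ≡⟨ ^-distrib-* (+ (u * u)) (+ 3) h ⟩
    (+ (u * u)) ℤ.^ h ℤ.* (+ 3) ℤ.^ h     ≈⟨ mod-* (square-power h u P-prime P∤u) (3-nonresidue m P-prime) ⟩
    + 1 ℤ.* ℤ.- + 1                       ≡⟨ ℤₚ.*-identityˡ (ℤ.- + 1) ⟩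
    ℤ.- + 1                               ∎
    where
    open ≡-mod-Reasoning (suc (2 * (2 + 12 * m)))
    h : ℕ
    h = 2 + 12 * m
    P∤u : ¬ suc (2 * (2 + 12 * m)) ∣ u
    P∤u = ∤-large (divides (u * 3) (identity u)) (ℕₚ.*-mono-≤ (ℕₚ.*-mono-≤ 1≤u 1≤u) (s≤s (z≤n {2}))) g<P
      where identity : ∀ u → u * u * 3 ≡ u * 3 * u
            identity = solve-∀

signed-power : ∀ e t ℓ b h′ v → Prime (suc (2 * suc (2 * h′))) → ¬ suc (2 * suc (2 * h′)) ∣ t →
               (+ ℓ) ℤ.^ suc (2 * h′) ≡ v [mod suc (2 * suc (2 * h′)) ] →
               (+ b) ℤ.^ suc (2 * h′) ≡ + 1 [mod suc (2 * suc (2 * h′)) ] → -1^ e ℤ.* v ≡ ℤ.- + 1 →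
               (-1^ e ℤ.* + (t * t * ℓ * b)) ℤ.^ suc (2 * h′) ≡ ℤ.- + 1 [mod suc (2 * suc (2 * h′)) ]
signed-power e t ℓ b h′ v P-prime P∤t ℓ^h≡v b^h≡1 sign = begin
  (-1^ e ℤ.* + (t * t * ℓ * b)) ℤ.^ h                       ≡⟨ ^-distrib-* (-1^ e) (+ (t * t * ℓ * b)) h ⟩
  (-1^ e) ℤ.^ h ℤ.* (+ (t * t * ℓ * b)) ℤ.^ h               ≡⟨ cong₂ ℤ._*_ (-1^-odd-power e h′) (cong (ℤ._^ h) split) ⟩
  -1^ e ℤ.* (+ (t * t) ℤ.* + ℓ ℤ.* + b) ℤ.^ h
    ≡⟨ cong (-1^ e ℤ.*_) (trans (^-distrib-* (+ (t * t) ℤ.* + ℓ) (+ b) h)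
                              (cong (ℤ._* (+ b) ℤ.^ h) (^-distrib-* (+ (t * t)) (+ ℓ) h))) ⟩
  -1^ e ℤ.* ((+ (t * t)) ℤ.^ h ℤ.* (+ ℓ) ℤ.^ h ℤ.* (+ b) ℤ.^ h)
    ≈⟨ mod-* (mod-refl {x = -1^ e}) (mod-* (mod-* (square-power h t P-prime P∤t) ℓ^h≡v) b^h≡1) ⟩
  -1^ e ℤ.* (+ 1 ℤ.* v ℤ.* + 1)                             ≡⟨ cong (-1^ e ℤ.*_) (identity v) ⟩
  -1^ e ℤ.* v                                               ≡⟨ sign ⟩
  ℤ.- + 1                                                   ∎
  where
  open ≡-mod-Reasoning (suc (2 * suc (2 * h′)))
  h : ℕ
  h = suc (2 * h′)
  split : + (t * t * ℓ * b) ≡ + (t * t) ℤ.* + ℓ ℤ.* + b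
  split = trans (ℤₚ.pos-* (t * t * ℓ) b) (cong (ℤ._* + b) (ℤₚ.pos-* (t * t) ℓ))
  identity : ∀ v → + 1 ℤ.* v ℤ.* + 1 ≡ v
  identity = ℤRing.solve-∀

module SignedProgression
  (e t ℓ b A B : ℕ) (Q′ : ℕ → ℕ) (v : ℤ) (1≤t : 1 ≤ t) (1≤ℓ : 1 ≤ ℓ) (1≤b : 1 ≤ b) (1≤A : 1 ≤ A)
  (q≡ : ∀ m → A * m + B ≡ suc (2 * Q′ m))
  (admissible-at : ∀ r → Prime r → r ∣ 2 * 1 * A → ¬ r ∣ B * (2 * 1 * B + 1))
  (ℓ^h≡v : ∀ m → Prime (suc (2 * suc (2 * Q′ m))) → ¬ suc (2 * suc (2 * Q′ m)) ∣ ℓ →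
           (+ ℓ) ℤ.^ suc (2 * Q′ m) ≡ v [mod suc (2 * suc (2 * Q′ m)) ])
  (b^h≡1 : ∀ m → Prime (suc (2 * suc (2 * Q′ m))) → ¬ suc (2 * suc (2 * Q′ m)) ∣ b →
           (+ b) ℤ.^ suc (2 * Q′ m) ≡ + 1 [mod suc (2 * suc (2 * Q′ m)) ])
  (sign : -1^ e ℤ.* v ≡ ℤ.- + 1) where

  a : ℕ
  a = t * t * ℓ * b
  g : ℤ
  g = -1^ e ℤ.* + a

  1≤a : 1 ≤ a
  1≤a = ℕₚ.*-mono-≤ (ℕₚ.*-mono-≤ (ℕₚ.*-mono-≤ 1≤t 1≤t) 1≤ℓ) 1≤b

  nonresidue : ∀ m → Prime (suc (2 * suc (2 * Q′ m))) → a < suc (2 * suc (2 * Q′ m)) →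
               g ℤ.^ suc (2 * Q′ m) ≡ ℤ.- + 1 [mod suc (2 * suc (2 * Q′ m)) ]
  nonresidue m P-prime a<P = signed-power e t ℓ b (Q′ m) v P-prime
    (∤-large (divides (t * ℓ * b) (identity₁ t ℓ b)) 1≤a a<P)
    (ℓ^h≡v m P-prime (∤-large (divides (t * t * b) (identity₂ t ℓ b)) 1≤a a<P))
    (b^h≡1 m P-prime (∤-large (divides (t * t * ℓ) refl) 1≤a a<P)) sign
    where identity₁ : ∀ t ℓ b → t * t * ℓ * b ≡ t * ℓ * b * t
          identity₁ = solve-∀
          identity₂ : ∀ t ℓ b → t * t * ℓ * b ≡ t * t * b * ℓ
          identity₂ = solve-∀

  progression : NonResidueProgression g
  progression = record
    { j = 1 ; A = A ; B = B ; j≡1∨2 = inj₁ refl ; 1≤A = 1≤A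
    ; admissible-at = admissible-at
    ; nonresidue = λ m _ P-prime g<P → nonresidue-at (suc (2 * Q′ m)) (q≡ m)
        (nonresidue m (subst (λ z → Prime (suc (2 * z))) (q≡ m) P-prime)
                      (subst₂ (λ x z → x < suc (2 * z)) (∣-1^e*a∣ e a) (q≡ m) g<P))
    }

prime∣8b⇒∣2b : ∀ {r} b → Prime r → r ∣ 8 * b → r ∣ 2 * b
prime∣8b⇒∣2b b r-prime r∣8b with euclidsLemma 8 b r-prime r∣8b
... | inj₂ r∣b = ∣n⇒∣m*n 2 r∣b
... | inj₁ r∣8 with euclidsLemma 2 4 r-prime r∣8
...   | inj₁ r∣2 = ∣-trans r∣2 (m∣m*n b)
...   | inj₂ r∣4 with euclidsLemma 2 2 r-prime r∣4
...     | inj₁ r∣2 = ∣-trans r∣2 (m∣m*n b)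
...     | inj₂ r∣2 = ∣-trans r∣2 (m∣m*n b)

∣B+1⇒∤B[2B+1] : ∀ {r} B → Prime r → r ∣ B + 1 → ¬ r ∣ B * (2 * B + 1)
∣B+1⇒∤B[2B+1] {r} B r-prime r∣B+1 r∣ with euclidsLemma B (2 * B + 1) r-prime r∣
... | inj₁ r∣B    = prime∤1 r-prime (∣m+n∣m⇒∣n r∣B+1 r∣B)
... | inj₂ r∣2B+1 = prime∤1 r-prime (∣m+n∣m⇒∣n (subst (r ∣_) (identity B) (∣n⇒∣m*n 2 r∣B+1)) r∣2B+1)
  where identity : ∀ B → 2 * (B + 1) ≡ 2 * B + 1 + 1
        identity = solve-∀

-- For g > 0 we need 2 to be a non-residue (P ≡ 3 mod 8), for g < 0 a residue (P ≡ 7 mod 8);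
-- in both cases P ≡ -1 mod 2b makes b a residue.
2·odd-progression : ∀ e t β → e ≤ 1 → 1 ≤ t → NonResidueProgression (-1^ e ℤ.* + (t * t * 2 * suc (2 * β)))
2·odd-progression zero t β _ 1≤t = SignedProgression.progression 0 t 2 b (4 * b) (4 * β + 1) (λ m → 2 * b * m + 2 * β) (ℤ.- + 1)
  1≤t (s≤s z≤n) (s≤s z≤n) (s≤s z≤n) (q≡ β) admissible-at 2^h≡-1
  (λ m P-prime P∤b → odd-residue (2 * b * m + 2 * β) β (4 * m + 2) P-prime P∤b (P+1≡ β m)) refl
  where
  b : ℕ
  b = suc (2 * β)
  q≡ : ∀ β m → 4 * suc (2 * β) * m + (4 * β + 1) ≡ suc (2 * (2 * suc (2 * β) * m + 2 * β))
  q≡ = solve-∀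
  P+1≡ : ∀ β m → suc (2 * suc (2 * (2 * suc (2 * β) * m + 2 * β))) + 1 ≡ suc (2 * β) * (2 * (4 * m + 2))
  P+1≡ = solve-∀
  h≡ : ∀ β m → suc (2 * (2 * suc (2 * β) * m + 2 * β)) ≡ suc (4 * (suc (2 * β) * m + β))
  h≡ = solve-∀
  admissible-at : ∀ r → Prime r → r ∣ 2 * 1 * (4 * b) → ¬ r ∣ (4 * β + 1) * (2 * 1 * (4 * β + 1) + 1)
  admissible-at r r-prime r∣8b = ∣B+1⇒∤B[2B+1] (4 * β + 1) r-prime
    (∣-trans (prime∣8b⇒∣2b b r-prime (subst (r ∣_) (identity b) r∣8b)) (divides 1 (identity′ β)))
    where identity : ∀ b → 2 * 1 * (4 * b) ≡ 8 * b
          identity = solve-∀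
          identity′ : ∀ β → 4 * β + 1 + 1 ≡ 1 * (2 * suc (2 * β))
          identity′ = solve-∀
  2^h≡-1 : ∀ m → Prime (suc (2 * suc (2 * (2 * b * m + 2 * β)))) → ¬ suc (2 * suc (2 * (2 * b * m + 2 * β))) ∣ 2 →
           (+ 2) ℤ.^ suc (2 * (2 * b * m + 2 * β)) ≡ ℤ.- + 1 [mod suc (2 * suc (2 * (2 * b * m + 2 * β))) ]
  2^h≡-1 m P-prime _ = subst (λ z → Prime (suc (2 * z)) → (+ 2) ℤ.^ z ≡ ℤ.- + 1 [mod suc (2 * z) ])
                             (sym (h≡ β m)) (2-nonresidue (b * m + β)) P-prime
2·odd-progression (suc zero) t β _ 1≤t = SignedProgression.progression 1 t 2 b (4 * b) (8 * β + 3) (λ m → 2 * b * m + 4 * β + 1) (+ 1)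
  1≤t (s≤s z≤n) (s≤s z≤n) (s≤s z≤n) (q≡ β) admissible-at 2^h≡1
  (λ m P-prime P∤b → odd-residue (2 * b * m + 4 * β + 1) β (4 * m + 4) P-prime P∤b (P+1≡ β m)) refl
  where
  b : ℕ
  b = suc (2 * β)
  q≡ : ∀ β m → 4 * suc (2 * β) * m + (8 * β + 3) ≡ suc (2 * (2 * suc (2 * β) * m + 4 * β + 1))
  q≡ = solve-∀
  P+1≡ : ∀ β m → suc (2 * suc (2 * (2 * suc (2 * β) * m + 4 * β + 1))) + 1 ≡ suc (2 * β) * (2 * (4 * m + 4))
  P+1≡ = solve-∀
  h≡ : ∀ β m → suc (2 * (2 * suc (2 * β) * m + 4 * β + 1)) ≡ 3 + 4 * (suc (2 * β) * m + 2 * β)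
  h≡ = solve-∀
  admissible-at : ∀ r → Prime r → r ∣ 2 * 1 * (4 * b) → ¬ r ∣ (8 * β + 3) * (2 * 1 * (8 * β + 3) + 1)
  admissible-at r r-prime r∣8b = ∣B+1⇒∤B[2B+1] (8 * β + 3) r-prime
    (∣-trans (prime∣8b⇒∣2b b r-prime (subst (r ∣_) (identity b) r∣8b)) (divides 2 (identity′ β)))
    where identity : ∀ b → 2 * 1 * (4 * b) ≡ 8 * b
          identity = solve-∀
          identity′ : ∀ β → 8 * β + 3 + 1 ≡ 2 * (2 * suc (2 * β))
          identity′ = solve-∀
  2^h≡1 : ∀ m → Prime (suc (2 * suc (2 * (2 * b * m + 4 * β + 1)))) → ¬ suc (2 * suc (2 * (2 * b * m + 4 * β + 1))) ∣ 2 →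
          (+ 2) ℤ.^ suc (2 * (2 * b * m + 4 * β + 1)) ≡ + 1 [mod suc (2 * suc (2 * (2 * b * m + 4 * β + 1))) ]
  2^h≡1 m P-prime _ = subst (λ z → Prime (suc (2 * z)) → (+ 2) ℤ.^ z ≡ + 1 [mod suc (2 * z) ])
                            (sym (h≡ β m)) (2-residue (b * m + 2 * β)) P-prime
2·odd-progression (suc (suc e)) t β (s≤s ()) _

mod-+1-cancel : ∀ {m x y} → x ℤ.+ + 1 ≡ y ℤ.+ + 1 [mod m ] → x ≡ y [mod m ]
mod-+1-cancel {m} {x} {y} (mod d) = mod (subst (+ m ℤ÷.∣_) (identity x y) d)
  where identity : ∀ x y → (x ℤ.+ + 1) ℤ.- (y ℤ.+ + 1) ≡ x ℤ.- y
        identity = ℤRing.solve-∀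

prime∣prime⇒≡ : ∀ {r ℓ} → Prime r → Prime ℓ → r ∣ ℓ → r ≡ ℓ
prime∣prime⇒≡ r-prime ℓ-prime r∣ℓ with prime⇒irreducible ℓ-prime r∣ℓ
... | inj₁ refl = ⊥-elim (prime∤1 r-prime ∣-refl)
... | inj₂ r≡ℓ  = r≡ℓ

-- X = E ^ (2l - 1) y, as E ^ 2l ≡ 1 by Fermat.
divide-mod : ∀ l E y → 1 ≤ l → Prime (suc (2 * l)) → ¬ suc (2 * l) ∣ E → 1 ≤ E → 1 ≤ y →
             ∃ λ X → 1 ≤ X × + (E * X) ≡ + y [mod suc (2 * l) ]
divide-mod l E y 1≤l ℓ-prime ℓ∤E 1≤E 1≤y = X , 1≤X , (begin
  + (E * X)                           ≡⟨ cong +_ (identity E (E ^ l) (E ^ (l ∸ 1)) y) ⟩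
  + (E ^ l * E ^ suc (l ∸ 1) * y)     ≡⟨ cong (λ z → + (E ^ l * E ^ z * y)) (ℕₚ.m+[n∸m]≡n 1≤l) ⟩
  + (E ^ l * E ^ l * y)               ≡⟨ trans (ℤₚ.pos-* (E ^ l * E ^ l) y) (cong (ℤ._* + y) (ℤₚ.pos-* (E ^ l) (E ^ l))) ⟩
  + (E ^ l) ℤ.* + (E ^ l) ℤ.* + y     ≡⟨ cong₂ (λ x z → x ℤ.* z ℤ.* + y) (pos-^ E l) (pos-^ E l) ⟨
  (+ E) ℤ.^ l ℤ.* (+ E) ℤ.^ l ℤ.* + y ≈⟨ mod-* (fermat l E ℓ-prime ℓ∤E) (mod-refl {x = + y}) ⟩
  + 1 ℤ.* + y                         ≡⟨ ℤₚ.*-identityˡ (+ y) ⟩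
  + y                                 ∎)
  where
  open ≡-mod-Reasoning (suc (2 * l))
  X : ℕ
  X = E ^ l * E ^ (l ∸ 1) * y
  1≤X : 1 ≤ X
  1≤X = ℕₚ.*-mono-≤ (ℕₚ.*-mono-≤ (ℕₚ.m^n>0 E {{ℕ.>-nonZero 1≤E}} l) (ℕₚ.m^n>0 E {{ℕ.>-nonZero 1≤E}} (l ∸ 1))) 1≤y
  identity : ∀ E u v w → E * (u * v * w) ≡ u * (E * v) * w
  identity = solve-∀

ℓ∤8b : ∀ l b → 1 ≤ l → Prime (suc (2 * l)) → ¬ suc (2 * l) ∣ b → ¬ suc (2 * l) ∣ 8 * b
ℓ∤8b l b 1≤l ℓ-prime ℓ∤b ℓ∣8b with euclidsLemma 8 b ℓ-prime ℓ∣8b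
... | inj₂ ℓ∣b = ℓ∤b ℓ∣b
... | inj₁ ℓ∣8 = prime∤-small (s≤s z≤n) (s≤s (ℕₚ.*-monoʳ-≤ 2 1≤l)) (prime∣8b⇒∣2b 1 ℓ-prime ℓ∣8)

-- With q = 4bℓm + B and P = 2q + 1 we get 8b ∣ P + 1, making b a residue, and P ≡ c (mod ℓ).
module OddPrimeProgression
  (e t l b c : ℕ) (1≤t : 1 ≤ t) (1≤l : 1 ≤ l) (1≤b : 1 ≤ b)
  (ℓ-prime : Prime (suc (2 * l)))
  (2≤c : 2 ≤ c) (c≤2l : c ≤ 2 * l) (c-character : -1^ μ c l ≡ -1^ (1 + e + l))
  (X W : ℕ) (E*X≡c+1 : + (8 * b * X) ≡ + (c + 1) [mod suc (2 * l) ]) (1+W≡ : suc W ≡ 2 * b * X) where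

  ℓ : ℕ
  ℓ = suc (2 * l)
  E : ℕ
  E = 8 * b
  B : ℕ
  B = suc (2 * W)

  ≡c : ∀ x k → x + 1 ≡ E * X + k * ℓ → + x ≡ + c [mod ℓ ]
  ≡c x k x+1≡ = mod-+1-cancel (begin
    + x ℤ.+ + 1                  ≡⟨ ℤₚ.pos-+ x 1 ⟨
    + (x + 1)                    ≡⟨ cong +_ x+1≡ ⟩
    + (E * X + k * ℓ)            ≡⟨ trans (ℤₚ.pos-+ (E * X) (k * ℓ)) (cong (ℤ._+_ (+ (E * X))) (ℤₚ.pos-* k ℓ)) ⟩
    + (E * X) ℤ.+ + k ℤ.* + ℓ    ≈⟨ +-multiple-mod (+ (E * X)) (+ k) ⟩
    + (E * X)                    ≈⟨ E*X≡c+1 ⟩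
    + (c + 1)                    ≡⟨ ℤₚ.pos-+ c 1 ⟩
    + c ℤ.+ + 1                  ∎)
    where open ≡-mod-Reasoning ℓ

  2b∣B+1 : 2 * b ∣ B + 1
  2b∣B+1 = divides (2 * X) (trans (identity₁ W) (trans (cong (2 *_) 1+W≡) (identity₂ b X)))
    where identity₁ : ∀ W → suc (2 * W) + 1 ≡ 2 * suc W
          identity₁ = solve-∀
          identity₂ : ∀ b X → 2 * (2 * b * X) ≡ 2 * X * (2 * b)
          identity₂ = solve-∀

  ℓ∤c : ¬ ℓ ∣ c
  ℓ∤c = prime∤-small (ℕₚ.≤-trans (s≤s z≤n) 2≤c) (s≤s c≤2l)

  2B+1≡c : + (2 * B + 1) ≡ + c [mod ℓ ]
  2B+1≡c = ≡c (2 * B + 1) 0 (trans (identity W) (trans (cong (4 *_) 1+W≡) (identity′ b X)))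
    where identity : ∀ W → 2 * suc (2 * W) + 1 + 1 ≡ 4 * suc W
          identity = solve-∀
          identity′ : ∀ b X → 4 * (2 * b * X) ≡ 8 * b * X + 0
          identity′ = solve-∀

  ℓ∤B[2B+1] : ¬ ℓ ∣ B * (2 * B + 1)
  ℓ∤B[2B+1] ℓ∣ = [ ℓ∤B , ℓ∤2B+1 ]′ (euclidsLemma B (2 * B + 1) ℓ-prime ℓ∣)
    where
    ℓ∤2B+1 : ¬ ℓ ∣ 2 * B + 1
    ℓ∤2B+1 ℓ∣2B+1 = ℓ∤c (mod-∣ 2B+1≡c ℓ∣2B+1)
    ℓ∤B : ¬ ℓ ∣ B
    ℓ∤B ℓ∣B = ℕₚ.<⇒≱ 2≤c (ℕₚ.≤-reflexive (mod⇒≡ c 1 (s≤s c≤2l) (s≤s (ℕₚ.≤-trans 1≤l (ℕₚ.m≤m+n l (l + 0)))) (begin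
      + c                        ≈⟨ 2B+1≡c ⟨
      + (2 * B + 1)              ≡⟨ trans (ℤₚ.pos-+ (2 * B) 1) (cong (ℤ._+ + 1) (ℤₚ.pos-* 2 B)) ⟩
      + 2 ℤ.* + B ℤ.+ + 1        ≈⟨ mod-+ (mod-* (mod-refl {x = + 2}) (∣⇒mod-0 {x = + B} (ℤ÷.∣ᵤ⇒∣ ℓ∣B))) (mod-refl {x = + 1}) ⟩
      + 1                        ∎)))
      where open ≡-mod-Reasoning ℓ

  admissible-at : ∀ r → Prime r → r ∣ 2 * 1 * (4 * b * ℓ) → ¬ r ∣ B * (2 * 1 * B + 1)
  admissible-at r r-prime r∣8bℓ = [ r∣E⇒ , r∣ℓ⇒ ]′ (euclidsLemma E ℓ r-prime (subst (r ∣_) (identity b ℓ) r∣8bℓ))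
    where
    identity : ∀ b ℓ → 2 * 1 * (4 * b * ℓ) ≡ 8 * b * ℓ
    identity = solve-∀
    r∣E⇒ : r ∣ E → ¬ r ∣ B * (2 * B + 1)
    r∣E⇒ r∣E = ∣B+1⇒∤B[2B+1] B r-prime (∣-trans (prime∣8b⇒∣2b b r-prime r∣E) 2b∣B+1)
    r∣ℓ⇒ : r ∣ ℓ → ¬ r ∣ B * (2 * B + 1)
    r∣ℓ⇒ r∣ℓ = subst (λ z → ¬ z ∣ B * (2 * B + 1)) (sym (prime∣prime⇒≡ r-prime ℓ-prime r∣ℓ)) ℓ∤B[2B+1]

  Q′ : ℕ → ℕ
  Q′ m = 2 * b * ℓ * m + W

  q≡ : ∀ m → 4 * b * ℓ * m + B ≡ suc (2 * Q′ m)
  q≡ m = identity b ℓ m W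
    where identity : ∀ b ℓ m W → 4 * b * ℓ * m + suc (2 * W) ≡ suc (2 * (2 * b * ℓ * m + W))
          identity = solve-∀

  P+1≡ : ∀ m → suc (2 * suc (2 * Q′ m)) + 1 ≡ E * X + E * m * ℓ
  P+1≡ m = trans (identity₁ b ℓ m W) (trans (cong (λ z → 8 * b * ℓ * m + 4 * z) 1+W≡) (identity₂ b ℓ m X))
    where identity₁ : ∀ b ℓ m W → suc (2 * suc (2 * (2 * b * ℓ * m + W))) + 1 ≡ 8 * b * ℓ * m + 4 * suc W
          identity₁ = solve-∀
          identity₂ : ∀ b ℓ m X → 8 * b * ℓ * m + 4 * (2 * b * X) ≡ 8 * b * X + 8 * b * m * ℓ
          identity₂ = solve-∀

  ℓ^h≡ : ∀ m → Prime (suc (2 * suc (2 * Q′ m))) → ¬ suc (2 * suc (2 * Q′ m)) ∣ ℓ →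
         (+ ℓ) ℤ.^ suc (2 * Q′ m) ≡ -1^ l ℤ.* -1^ μ c l [mod suc (2 * suc (2 * Q′ m)) ]
  ℓ^h≡ m P-prime P∤ℓ = mod-trans (gauss-lemma h ℓ P-prime P∤ℓ) (mod-reflexive (begin
    -1^ μ ℓ h                    ≡⟨ quadratic-reciprocity h l P-prime ℓ-prime P∤ℓ ℓ∤P ⟩
    -1^ (h * l) ℤ.* -1^ μ P l    ≡⟨ cong₂ ℤ._*_ (-1^-odd* (Q′ m) l) (cong -1^_ (μ-cong P c l (mod⇒%≡ P c P≡c))) ⟩
    -1^ l ℤ.* -1^ μ c l          ∎))
    where
    open ≡-Reasoning
    h : ℕ
    h = suc (2 * Q′ m)
    P : ℕ
    P = suc (2 * h)
    P≡c : + P ≡ + c [mod ℓ ]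
    P≡c = ≡c P (E * m) (P+1≡ m)
    ℓ∤P : ¬ ℓ ∣ P
    ℓ∤P ℓ∣P = ℓ∤c (mod-∣ P≡c ℓ∣P)

  b^h≡1 : ∀ m → Prime (suc (2 * suc (2 * Q′ m))) → ¬ suc (2 * suc (2 * Q′ m)) ∣ b →
          (+ b) ℤ.^ suc (2 * Q′ m) ≡ + 1 [mod suc (2 * suc (2 * Q′ m)) ]
  b^h≡1 m P-prime P∤b = residue-of-divisor (Q′ m) b P-prime 1≤b (divides (X + m * ℓ) (trans (P+1≡ m) (identity b X m ℓ))) P∤b
    where identity : ∀ b X m ℓ → 8 * b * X + 8 * b * m * ℓ ≡ (X + m * ℓ) * (8 * b)
          identity = solve-∀

  sign : -1^ e ℤ.* (-1^ l ℤ.* -1^ μ c l) ≡ ℤ.- + 1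
  sign = begin
    -1^ e ℤ.* (-1^ l ℤ.* -1^ μ c l)          ≡⟨ cong (λ z → -1^ e ℤ.* (-1^ l ℤ.* z)) c-character ⟩
    -1^ e ℤ.* (-1^ l ℤ.* -1^ (1 + e + l))    ≡⟨ cong (-1^ e ℤ.*_) (-1^-+ l (1 + e + l)) ⟨
    -1^ e ℤ.* -1^ (l + (1 + e + l))          ≡⟨ -1^-+ e (l + (1 + e + l)) ⟨
    -1^ (e + (l + (1 + e + l)))              ≡⟨ cong -1^_ (identity e l) ⟩
    -1^ suc (2 * (e + l))                    ≡⟨ cong ℤ.-_ (-1^-2* (e + l)) ⟩
    ℤ.- + 1                                  ∎
    where
    open ≡-Reasoning
    identity : ∀ e l → e + (l + (1 + e + l)) ≡ suc (2 * (e + l))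
    identity = solve-∀

  progression : NonResidueProgression (-1^ e ℤ.* + (t * t * ℓ * b))
  progression = SignedProgression.progression e t ℓ b (4 * b * ℓ) B Q′ (-1^ l ℤ.* -1^ μ c l)
    1≤t (s≤s z≤n) 1≤b (ℕₚ.*-mono-≤ (ℕₚ.*-mono-≤ {1} {4} (s≤s z≤n) 1≤b) (s≤s z≤n)) q≡ admissible-at ℓ^h≡ b^h≡1 sign

prime-2l+1⇒1≤l : ∀ {l} → Prime (suc (2 * l)) → 1 ≤ l
prime-2l+1⇒1≤l {zero}  ℓ-prime = ⊥-elim (prime∤1 ℓ-prime ∣-refl)
prime-2l+1⇒1≤l {suc l} _       = s≤s z≤n

-- The progression will have P ≡ c (mod ℓ), so by reciprocity c fixes the character of ℓ;
-- c ≠ 1 is needed for admissibility at ℓ.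
suitable-residue : ∀ e l → 1 ≤ l → Prime (suc (2 * l)) → (l ≡ 1 → e ≡ 1) →
                   ∃ λ c → 2 ≤ c × c ≤ 2 * l × -1^ μ c l ≡ -1^ (1 + e + l)
suitable-residue e l 1≤l ℓ-prime l≡1⇒e≡1 with -1^-cases (1 + e + l)
... | inj₂ negative with ∃-nonresidue l 1≤l ℓ-prime
...   | c , 1≤c , c≤2l , c-nonresidue = c , 2≤c c 1≤c c-nonresidue , c≤2l , trans c-nonresidue (sym negative)
  where
  2≤c : ∀ c → 1 ≤ c → -1^ μ c l ≡ ℤ.- + 1 → 2 ≤ c
  2≤c (suc zero)    _ 1-nonresidue with () ← trans (sym (cong -1^_ (μ-1 l))) 1-nonresidue
  2≤c (suc (suc _)) _ _ = s≤s (s≤s z≤n)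
suitable-residue e l 1≤l ℓ-prime l≡1⇒e≡1 | inj₁ positive =
  4 , s≤s (s≤s z≤n) , ℕₚ.*-monoʳ-≤ 2 2≤l , trans (4-residue l 2≤l ℓ-prime) (sym positive)
  where
  2≤l : 2 ≤ l
  2≤l = l≢1 e l 1≤l l≡1⇒e≡1 positive
    where
    l≢1 : ∀ e l → 1 ≤ l → (l ≡ 1 → e ≡ 1) → -1^ (1 + e + l) ≡ + 1 → 2 ≤ l
    l≢1 e (suc zero) _ l≡1⇒e≡1 -1^[e+2]≡1 with refl ← l≡1⇒e≡1 refl with () ← -1^[e+2]≡1
    l≢1 e (suc (suc _)) _ _ _ = s≤s (s≤s z≤n)

odd-prime-progression : ∀ e t l b → 1 ≤ t → 1 ≤ b → Prime (suc (2 * l)) → ¬ suc (2 * l) ∣ b → (l ≡ 1 → e ≡ 1) →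
                        NonResidueProgression (-1^ e ℤ.* + (t * t * suc (2 * l) * b))
odd-prime-progression e t l b 1≤t 1≤b ℓ-prime ℓ∤b l≡1⇒e≡1 = from-residue (suitable-residue e l 1≤l ℓ-prime l≡1⇒e≡1)
  where
  1≤l : 1 ≤ l
  1≤l = prime-2l+1⇒1≤l ℓ-prime
  Goal : Set
  Goal = NonResidueProgression (-1^ e ℤ.* + (t * t * suc (2 * l) * b))
  from-residue : (∃ λ c → 2 ≤ c × c ≤ 2 * l × -1^ μ c l ≡ -1^ (1 + e + l)) → Goal
  from-residue (c , 2≤c , c≤2l , c-character) = from-inverse
    (divide-mod l (8 * b) (c + 1) 1≤l ℓ-prime (ℓ∤8b l b 1≤l ℓ-prime ℓ∤b) (ℕₚ.*-mono-≤ {1} {8} (s≤s z≤n) 1≤b) (ℕₚ.m≤n+m 1 c))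
    where
    from-inverse : (∃ λ X → 1 ≤ X × + (8 * b * X) ≡ + (c + 1) [mod suc (2 * l) ]) → Goal
    from-inverse (X , 1≤X , E*X≡c+1) = OddPrimeProgression.progression e t l b c 1≤t 1≤l 1≤b ℓ-prime 2≤c c≤2l c-character
      X (2 * b * X ∸ 1) E*X≡c+1 (ℕₚ.m+[n∸m]≡n (ℕₚ.*-mono-≤ (ℕₚ.*-mono-≤ {1} {2} (s≤s z≤n) 1≤b) 1≤X))

-- The shapes of non-square integers

data Shape : ℤ → Set where
  -square    : ∀ t → 2 ≤ t → Shape (ℤ.- + (t * t))
  3·square   : ∀ u → 1 ≤ u → Shape (+ (u * u * 3))
  ±square·ℓb : ∀ e t ℓ b → e ≤ 1 → 1 ≤ t → Prime ℓ → 1 ≤ b → ¬ ℓ ∣ b → (ℓ ≡ 3 → e ≡ 1) →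
               Shape (-1^ e ℤ.* + (t * t * ℓ * b))

Shape⇒progression : ∀ {g} → Shape g → NonResidueProgression g
Shape⇒progression (-square t 2≤t) = -square-progression t 2≤t
Shape⇒progression (3·square u 1≤u) = 3·square-progression u 1≤u
Shape⇒progression (±square·ℓb e t ℓ b e≤1 1≤t ℓ-prime 1≤b ℓ∤b ℓ≡3⇒e≡1) with ℓ ≟ 2
... | yes refl with parity b
...   | odd β   = 2·odd-progression e t β e≤1 1≤t
...   | even b′ = ⊥-elim (ℓ∤b (divides b′ (ℕₚ.*-comm 2 b′)))
Shape⇒progression (±square·ℓb e t ℓ b e≤1 1≤t ℓ-prime 1≤b ℓ∤b ℓ≡3⇒e≡1) | no ℓ≢2 with parity ℓ
...   | odd l  = odd-prime-progression e t l b 1≤t 1≤b ℓ-prime ℓ∤b (λ l≡1 → ℓ≡3⇒e≡1 (cong (λ z → suc (2 * z)) l≡1))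
...   | even k = ⊥-elim (ℓ≢2 (sym (prime∣prime⇒≡ prime[2] ℓ-prime (divides k (ℕₚ.*-comm 2 k)))))

Shape⇒2≤∣g∣ : ∀ {g} → Shape g → 2 ≤ ∣ g ∣
Shape⇒2≤∣g∣ (-square t 2≤t) =
  subst (2 ≤_) (sym (ℤₚ.∣-i∣≡∣i∣ (+ (t * t)))) (ℕₚ.≤-trans 2≤t (ℕₚ.m≤m*n t t {{ℕ.>-nonZero (ℕₚ.<-trans (s≤s z≤n) 2≤t)}}))
Shape⇒2≤∣g∣ (3·square u 1≤u) = ℕₚ.≤-trans (s≤s (s≤s z≤n)) (ℕₚ.*-mono-≤ (ℕₚ.*-mono-≤ 1≤u 1≤u) (ℕₚ.≤-refl {3}))
Shape⇒2≤∣g∣ (±square·ℓb e t ℓ b _ 1≤t ℓ-prime 1≤b _ _) = subst (2 ≤_) (sym (∣-1^e*a∣ e (t * t * ℓ * b)))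
  (ℕₚ.*-mono-≤ (ℕₚ.*-mono-≤ (ℕₚ.*-mono-≤ 1≤t 1≤t) (prime⇒2≤ ℓ-prime)) 1≤b)

IsSquareℕ : ℕ → Set
IsSquareℕ a = ∃ λ s → s * s ≡ a

square? : ∀ a → Dec (IsSquareℕ a)
square? a with ℕₚ.anyUpTo? (λ s → s * s ≟ a) (suc a)
... | yes (s , _ , s²≡a) = yes (s , s²≡a)
... | no none = no λ (s , s²≡a) → none (s , s≤a s s²≡a , s²≡a)
  where
  s≤a : ∀ s → s * s ≡ a → s < suc a
  s≤a zero    _    = s≤s z≤n
  s≤a (suc s) s²≡a = s≤s (ℕₚ.≤-trans (ℕₚ.m≤m*n (suc s) (suc s)) (ℕₚ.≤-reflexive s²≡a))

prime-factor : ∀ a → 2 ≤ a → ∃ λ ℓ → Prime ℓ × ℓ ∣ a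
prime-factor a 2≤a with factorise a {{ℕ.>-nonZero (ℕₚ.<-trans (s≤s z≤n) 2≤a)}}
... | record { factors = [] ; isFactorisation = a≡1 } = ⊥-elim (ℕₚ.<⇒≱ 2≤a (ℕₚ.≤-reflexive a≡1))
... | record { factors = ℓ ∷ rest ; isFactorisation = a≡ ; factorsPrime = ℓ-prime ∷ _ } =
  ℓ , ℓ-prime , divides (product rest) (trans a≡ (ℕₚ.*-comm ℓ (product rest)))

record Decomposition (a : ℕ) : Set where
  field
    t ℓ b   : ℕ
    1≤t     : 1 ≤ t
    ℓ-prime : Prime ℓ
    1≤b     : 1 ≤ b
    ℓ∤b     : ¬ ℓ ∣ b
    a≡      : a ≡ t * t * ℓ * b

decompose : ∀ a → 1 ≤ a → ¬ IsSquareℕ a → Decomposition a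
decompose a = go a (<-wellFounded a)
  where
  go : ∀ a → Acc _<_ a → 1 ≤ a → ¬ IsSquareℕ a → Decomposition a
  go a (acc rec) 1≤a a≢□ with prime-factor a (2≤a a 1≤a a≢□)
    where 2≤a : ∀ a → 1 ≤ a → ¬ IsSquareℕ a → 2 ≤ a
          2≤a (suc zero)    _ 1≢□ = ⊥-elim (1≢□ (1 , refl))
          2≤a (suc (suc _)) _ _   = s≤s (s≤s z≤n)
  ... | ℓ , ℓ-prime , divides b a≡bℓ with ℓ * ℓ ∣? a
  ...   | no ℓ²∤a = record { t = 1 ; ℓ = ℓ ; b = b ; 1≤t = s≤s z≤n ; ℓ-prime = ℓ-prime ; 1≤b = 1≤b ; ℓ∤b = ℓ∤b
                           ; a≡ = trans a≡bℓ (identity b ℓ) }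
    where
    1≤b : 1 ≤ b
    1≤b = ℕₚ.n≢0⇒n>0 (λ b≡0 → ℕₚ.<⇒≱ 1≤a (ℕₚ.≤-reflexive (trans a≡bℓ (cong (_* ℓ) b≡0))))
    ℓ∤b : ¬ ℓ ∣ b
    ℓ∤b (divides c b≡cℓ) = ℓ²∤a (divides c (trans a≡bℓ (trans (cong (_* ℓ) b≡cℓ) (ℕₚ.*-assoc c ℓ ℓ))))
    identity : ∀ b ℓ → b * ℓ ≡ 1 * 1 * ℓ * b
    identity = solve-∀
  ...   | yes (divides a′ a≡a′ℓ²) = record
    { t = ℓ * t ; ℓ = ℓ′ ; b = b′ ; 1≤t = ℕₚ.*-mono-≤ (ℕₚ.<⇒≤ (prime⇒2≤ ℓ-prime)) 1≤t
    ; ℓ-prime = ℓ′-prime ; 1≤b = 1≤b′ ; ℓ∤b = ℓ′∤b′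
    ; a≡ = trans a≡a′ℓ² (trans (cong (_* (ℓ * ℓ)) a′≡) (identity t ℓ′ b′ ℓ)) }
    where
    1≤a′ : 1 ≤ a′
    1≤a′ = ℕₚ.n≢0⇒n>0 (λ a′≡0 → ℕₚ.<⇒≱ 1≤a (ℕₚ.≤-reflexive (trans a≡a′ℓ² (cong (_* (ℓ * ℓ)) a′≡0))))
    a′<a : a′ < a
    a′<a = subst (a′ <_) (sym a≡a′ℓ²)
      (ℕₚ.m<m*n a′ (ℓ * ℓ) {{ℕ.>-nonZero 1≤a′}} (ℕₚ.*-mono-≤ (prime⇒2≤ ℓ-prime) (ℕₚ.<⇒≤ (prime⇒2≤ ℓ-prime))))
    a′≢□ : ¬ IsSquareℕ a′
    a′≢□ (s , s²≡a′) = a≢□ (s * ℓ , trans (identity′ s ℓ) (trans (cong (_* (ℓ * ℓ)) s²≡a′) (sym a≡a′ℓ²)))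
      where identity′ : ∀ s ℓ → s * ℓ * (s * ℓ) ≡ s * s * (ℓ * ℓ)
            identity′ = solve-∀
    open Decomposition (go a′ (rec a′<a) 1≤a′ a′≢□)
      renaming (ℓ to ℓ′; b to b′; ℓ-prime to ℓ′-prime; 1≤b to 1≤b′; ℓ∤b to ℓ′∤b′; a≡ to a′≡)
    identity : ∀ t ℓ′ b′ ℓ → t * t * ℓ′ * b′ * (ℓ * ℓ) ≡ ℓ * t * (ℓ * t) * ℓ′ * b′
    identity = solve-∀

-- For g = 3t²b > 0 the prime 3 is unusable (no 2 ≤ c < 3 is a residue modulo 3), so another prime of b is split off.
shape-3·t²·b : ∀ t b → 1 ≤ t → 1 ≤ b → ¬ 3 ∣ b → Shape (+ (t * t * 3 * b))
shape-3·t²·b t b 1≤t 1≤b 3∤b with square? b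
... | yes (s , s²≡b) = subst Shape (cong +_ (trans (identity t s) (cong (t * t * 3 *_) s²≡b))) (3·square (t * s) (ℕₚ.*-mono-≤ 1≤t 1≤s))
  where
  1≤s : 1 ≤ s
  1≤s = ℕₚ.n≢0⇒n>0 (λ s≡0 → ℕₚ.<⇒≱ 1≤b (ℕₚ.≤-reflexive (trans (sym s²≡b) (cong (λ z → z * z) s≡0))))
  identity : ∀ t s → t * s * (t * s) * 3 ≡ t * t * 3 * (s * s)
  identity = solve-∀
... | no b≢□ = subst Shape (trans (ℤₚ.*-identityˡ _) (cong +_ (trans (identity t t′ ℓ b′) (cong (t * t * 3 *_) (sym b≡)))))
  (±square·ℓb 0 (t * t′) ℓ (3 * b′) z≤n (ℕₚ.*-mono-≤ 1≤t 1≤t′) ℓ-prime (ℕₚ.*-mono-≤ {1} {3} (s≤s z≤n) 1≤b′) ℓ∤3b′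
              (⊥-elim ∘ ℓ≢3))
  where
  open Decomposition (decompose b 1≤b b≢□) renaming (t to t′; b to b′; 1≤t to 1≤t′; 1≤b to 1≤b′; a≡ to b≡)
  identity : ∀ t t′ ℓ b′ → t * t′ * (t * t′) * ℓ * (3 * b′) ≡ t * t * 3 * (t′ * t′ * ℓ * b′)
  identity = solve-∀
  ℓ∣b : ℓ ∣ b
  ℓ∣b = divides (t′ * t′ * b′) (trans b≡ (identity′ t′ ℓ b′))
    where identity′ : ∀ t′ ℓ b′ → t′ * t′ * ℓ * b′ ≡ t′ * t′ * b′ * ℓ
          identity′ = solve-∀
  ℓ≢3 : ℓ ≢ 3
  ℓ≢3 ℓ≡3 = 3∤b (subst (_∣ b) ℓ≡3 ℓ∣b)
  ℓ∤3b′ : ¬ ℓ ∣ 3 * b′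
  ℓ∤3b′ ℓ∣3b′ with euclidsLemma 3 b′ ℓ-prime ℓ∣3b′
  ... | inj₁ ℓ∣3  = ℓ≢3 (prime∣prime⇒≡ ℓ-prime (from-yes (prime? 3)) ℓ∣3)
  ... | inj₂ ℓ∣b′ = ℓ∤b ℓ∣b′

shape : ∀ g → g ≢ -[1+ 0 ] → ¬ IsSquare g → Shape g
shape (+ zero)       _ g≢□ = ⊥-elim (g≢□ (+ 0 , refl))
shape (+ suc zero)   _ g≢□ = ⊥-elim (g≢□ (+ 1 , refl))
shape (+ suc (suc k)) _ g≢□ with decompose (suc (suc k)) (s≤s z≤n) (λ (s , s²≡a) → g≢□ (+ s , trans (cong +_ (sym s²≡a)) (ℤₚ.pos-* s s)))
... | record { t = t ; ℓ = ℓ ; b = b ; 1≤t = 1≤t ; ℓ-prime = ℓ-prime ; 1≤b = 1≤b ; ℓ∤b = ℓ∤b ; a≡ = a≡ } with ℓ ≟ 3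
...   | yes refl = subst Shape (cong +_ (sym a≡)) (shape-3·t²·b t b 1≤t 1≤b ℓ∤b)
...   | no ℓ≢3   = subst Shape (trans (ℤₚ.*-identityˡ _) (cong +_ (sym a≡)))
                     (±square·ℓb 0 t ℓ b z≤n 1≤t ℓ-prime 1≤b ℓ∤b (⊥-elim ∘ ℓ≢3))
shape -[1+ zero ]    g≢-1 _ = ⊥-elim (g≢-1 refl)
shape -[1+ suc k ]   _ _ with square? (suc (suc k))
... | yes (s , s²≡a) = subst (Shape ∘ ℤ.-_ ∘ +_) s²≡a (-square s (2≤s s s²≡a))
  where 2≤s : ∀ s → s * s ≡ suc (suc k) → 2 ≤ s
        2≤s (suc (suc _)) _ = s≤s (s≤s z≤n)
... | no a≢□ with decompose (suc (suc k)) (s≤s z≤n) a≢□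
...   | record { t = t ; ℓ = ℓ ; b = b ; 1≤t = 1≤t ; ℓ-prime = ℓ-prime ; 1≤b = 1≤b ; ℓ∤b = ℓ∤b ; a≡ = a≡ } =
  subst Shape (trans (ℤₚ.-1*i≡-i _) (cong (ℤ.-_ ∘ +_) (sym a≡))) (±square·ℓb 1 t ℓ b ℕₚ.≤-refl 1≤t ℓ-prime 1≤b ℓ∤b (λ _ → refl))

corollary1 : TC2 → (g : ℤ) → ¬ (g ≡ -[1+ 0 ]) → ¬ IsSquare g →
    InfinitelyManyℕ (λ p → Prime p × IsPrimitiveRoot g p)
corollary1 tc g g≢-1 g≢□ = primitive-roots tc (Shape⇒2≤∣g∣ g-shape) (Shape⇒progression g-shape)
  where g-shape : Shape g
        g-shape = shape g g≢-1 g≢□
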